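{- Let $m\ge 1$ and let $\mathcal{N}^0$ be a simple acyclic oriented matroid on the ground set $E_m:=\{1,\dots,m\}$, with set of topes $\mathcal{T}^0$. Let $s$ be an integer with $s\le m$, and let $\mathcal{N}^s:={}_{ -[1,s]}\mathcal{N}^0$ be the reorientation of $\mathcal{N}^0$ on the set $[1,s]=\{1,\dots,s\}$. (i) $\mathcal{N}^s$ has a tope committee $\mathcal{K}_s^{\ast}$ such that $|\mathcal{K}_s^{\ast}|\le m$ when $m$ is odd, and $|\mathcal{K}_s^{\ast}|\le m-1$ when $m$ is even. As a consequence, every simple oriented matroid $\mathcal{M}$ on $E_m$ has a tope committee $\mathcal{K}^{\ast}$ with $|\mathcal{K}^{\ast}|\le m$ if $m$ is odd and $|\mathcal{K}^{\ast}|\le m-1$ if $m$ is even. (ii) If $s\le\lfloor m/2\rfloor$, then $\mathcal{N}^s$ has a tope committee $\mathcal{K}_s^{\ast}$ with $|\mathcal{K}_s^{\ast}|\le 1+2s$.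
   Context: Standing assumption: all oriented matroids have rank at least $2$. An oriented matroid on a finite set $E$ is given by its set of covectors $\mathcal{L}\subseteq\{ -,0,+\}^E$ (satisfying the usual covector axioms); its topes are the covectors of inclusion-maximal support. For a sign vector $X$, $X^+:=\{e: X(e)=+\}$, $X^-:=\{e:X(e)=-\}$. For $A\subseteq E$, ${}_{ -A}X$ is obtained from $X$ by reversing the signs of the components in $A$; the reorientation ${}_{ -A}\mathcal{M}$ of $\mathcal{M}=(E,\mathcal{L})$ is the oriented matroid with covector set $\{{}_{ -A}X: X\in\mathcal{L}\}$. An oriented matroid is simple if it has no loops (elements $e$ with $T(e)=0$ for all topes $T$), no parallel elements ($e\ne f$ with $X(e)=X(f)$ for all covectors $X$) and no antiparallel elements ($e\neq f$ with $X(e)=-X(f)$ for all covectors $X$). It is acyclic if the all-plus sign vector $(+\cdots+)$ is a tope. A tope committee for an oriented matroid with ground set $E$ and tope set $\mathcal{T}$ is a subset $\mathcal{K}^{\ast}\subset\mathcal{T}$ such that for every $e\in E$, $|\{K\in\mathcal{K}^{\ast}: K(e)=+\}|>\tfrac12|\mathcal{K}^{\ast}|$. -}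

module Defs where

open import Data.Nat using (ℕ; zero; suc; _+_; _*_; _∸_; _≤_; _<_; _%_)
open import Data.Fin using (Fin; toℕ)
open import Data.Vec using (Vec; lookup; map; replicate; zipWith; tabulate)
open import Data.List using (List; length; filter)
open import Data.List.Relation.Unary.All using (All)
open import Data.List.Relation.Unary.Unique.Propositional using (Unique)
open import Data.Product using (Σ; _×_; ∃; ∃-syntax)
open import Relation.Binary.PropositionalEquality using (_≡_; _≢_)
open import Relation.Nullary using (¬_; Dec; yes; no)
open import Relation.Nullary.Decidable using (⌊_⌋)
open import Data.Bool using (Bool; true; false)

-- Signs and sign vectors on the ground set E_m, modelled as Fin m
-- (element i : Fin m corresponds to the element toℕ i + 1 of {1,…,m}).

data Sign : Set where
  minus zer plus : Sign

_≟ₛ_ : (a b : Sign) → Dec (a ≡ b)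
minus ≟ₛ minus = yes _≡_.refl
minus ≟ₛ zer   = no λ ()
minus ≟ₛ plus  = no λ ()
zer   ≟ₛ minus = no λ ()
zer   ≟ₛ zer   = yes _≡_.refl
zer   ≟ₛ plus  = no λ ()
plus  ≟ₛ minus = no λ ()
plus  ≟ₛ zer   = no λ ()
plus  ≟ₛ plus  = yes _≡_.refl

neg : Sign → Sign
neg minus = plus
neg zer   = zer
neg plus  = minus

_∘ₛ_ : Sign → Sign → Sign
zer   ∘ₛ b = b
minus ∘ₛ b = minus
plus  ∘ₛ b = plus

SignVec : ℕ → Set
SignVec m = Vec Sign m

zeroVec : ∀ {m} → SignVec m
zeroVec = replicate _ zer

plusVec : ∀ {m} → SignVec m
plusVec = replicate _ plus

negVec : ∀ {m} → SignVec m → SignVec m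
negVec = map neg

_∘ᵥ_ : ∀ {m} → SignVec m → SignVec m → SignVec m
_∘ᵥ_ = zipWith _∘ₛ_

_⊆supp_ : ∀ {m} → SignVec m → SignVec m → Set
X ⊆supp Y = ∀ e → lookup X e ≢ zer → lookup Y e ≢ zer

Separates : ∀ {m} → SignVec m → SignVec m → Fin _ → Set
Separates {m} X Y e = (lookup X e ≢ zer) × (lookup X e ≡ neg (lookup Y e))

data _⊑ₛ_ : Sign → Sign → Set where
  z⊑ : ∀ {b} → zer ⊑ₛ b
  r⊑ : ∀ {a} → a ⊑ₛ a

_⊑_ : ∀ {m} → SignVec m → SignVec m → Set
X ⊑ Y = ∀ e → lookup X e ⊑ₛ lookup Y e

-- Oriented matroids given by covector axioms (Björner et al., 4.1.1)

record IsOM (m : ℕ) (L : SignVec m → Set) : Set where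
  field
    L0 : L zeroVec
    L1 : ∀ X → L X → L (negVec X)
    L2 : ∀ X Y → L X → L Y → L (X ∘ᵥ Y)
    L3 : ∀ X Y → L X → L Y → ∀ e → Separates X Y e →
         ∃[ Z ] (L Z × lookup Z e ≡ zer ×
                 (∀ f → ¬ Separates X Y f → lookup Z f ≡ lookup (X ∘ᵥ Y) f))

-- Standing assumption: rank ≥ 2, i.e. there is a chain 0 < X < Y of
-- covectors in the conformal (face) order.
RankAtLeast2 : ∀ {m} → (SignVec m → Set) → Set
RankAtLeast2 L = ∃[ X ] ∃[ Y ] (L X × L Y × X ≢ zeroVec × X ⊑ Y × X ≢ Y)

record OM (m : ℕ) : Set₁ where
  field
    Cov   : SignVec m → Set
    isOM  : IsOM m Cov
    rank2 : RankAtLeast2 Cov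

IsTope : ∀ {m} → (SignVec m → Set) → SignVec m → Set
IsTope L T = L T × (∀ Y → L Y → T ⊆supp Y → Y ⊆supp T)

Simple : ∀ {m} → (SignVec m → Set) → Set
Simple {m} L =
  (∀ e → ∃[ T ] (IsTope L T × lookup T e ≢ zer))
  × (∀ (e f : Fin m) → e ≢ f → ∃[ X ] (L X × lookup X e ≢ lookup X f))
  × (∀ (e f : Fin m) → e ≢ f → ∃[ X ] (L X × lookup X e ≢ neg (lookup X f)))

Acyclic : ∀ {m} → (SignVec m → Set) → Set
Acyclic L = IsTope L plusVec

reorientSign : Bool → Sign → Sign
reorientSign true  a = neg a
reorientSign false a = a

reorient : ∀ {m} → (Fin m → Bool) → SignVec m → SignVec m
reorient A X = tabulate λ e → reorientSign (A e) (lookup X e)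

reorientCov : ∀ {m} → (Fin m → Bool) → (SignVec m → Set) → (SignVec m → Set)
reorientCov A L Y = ∃[ X ] (L X × Y ≡ reorient A X)

-- the interval [1,s] ⊆ E_m  (element i : Fin m is the integer toℕ i + 1)
interval1 : ∀ {m} → ℕ → Fin m → Bool
interval1 s e = ⌊ suc (toℕ e) Data.Nat.≤? s ⌋

countPlus : ∀ {m} → Fin m → List (SignVec m) → ℕ
countPlus e K = length (filter (λ T → lookup T e ≟ₛ plus) K)

IsTopeCommittee : ∀ {m} → (SignVec m → Set) → List (SignVec m) → Set
IsTopeCommittee {m} L K =
  Unique K × All (IsTope L) K × (∀ (e : Fin m) → length K < 2 * countPlus e K)

HasParityBoundedCommittee : ∀ {m} → (SignVec m → Set) → Set
HasParityBoundedCommittee {m} L =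
  ∃[ K ] (IsTopeCommittee L K
          × (m % 2 ≡ 1 → length K ≤ m)
          × (m % 2 ≡ 0 → length K ≤ m ∸ 1))

module Submission where

-- Reversing one element at a time, one can walk through the topes from a tope T to −T: a tope
-- T ≠ T′ always has a neighbour obtained by reversing an element that separates it from T′
-- (covector elimination, and simplicity when the eliminant vanishes on the whole separation
-- set). Continuing with the negated walk gives a cycle of 2m topes on which each element is
-- positive on an arc of m consecutive topes. The committee consists of the peaks of the cycle:
-- the topes entered by a step that makes an element positive and left by one that makes an
-- element negative. As peaks and valleys alternate, the arc on which an element is positive
-- carries exactly one more peak than the opposite arc. Antipodal symmetry turns the peaks of
-- one half of the cycle into the valleys of the other, so there are at most m peaks, an odd
-- number of them, and at most 1 + 2s if T has s negative entries.

open import Data.Bool using (Bool; true; false; not; _∧_; _xor_; if_then_else_)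
open import Data.Bool.Properties using (not-involutive; ∧-identityʳ; ∧-zeroʳ)
open import Data.Empty using (⊥-elim)
open import Data.Fin using (Fin; toℕ; zero; suc) renaming (_≟_ to _≟ᶠ_)
open import Data.Fin.Properties using (any?) renaming (suc-injective to Fin-suc-injective)
open import Data.List using (List; []; _∷_; length; filter)
open import Data.List.Relation.Unary.All using (All; []; _∷_)
open import Data.List.Relation.Unary.AllPairs using ([]; _∷_)
open import Data.List.Relation.Unary.Unique.Propositional using (Unique)
open import Data.Nat using (ℕ; zero; suc; _+_; _*_; _∸_; _≤_; _<_; z≤n; s≤s; z<s; _≤?_; _<?_; _≟_; _/_; _%_)
open import Data.Nat.DivMod using ([m+kn]%n≡m%n)
open import Data.Nat.Properties
open import Algebra.Properties.CommutativeSemigroup +-commutativeSemigroup using (x∙yz≈y∙xz; interchange)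
open import Data.Product using (_×_; _,_; proj₁; proj₂; ∃; ∃-syntax)
open import Data.Sum using (_⊎_; inj₁; inj₂)
open import Data.Unit using (⊤; tt)
open import Data.Vec using (lookup; tabulate; _[_]%=_)
open import Data.Vec.Functional using (updateAt)
open import Data.Vec.Functional.Properties using (updateAt-updates; updateAt-minimal)
open import Data.Vec.Properties
  using (tabulate-cong; tabulate∘lookup; lookup-map; lookup-zipWith; lookup-replicate; lookup∘tabulate;
         lookup∘updateAt; lookup∘updateAt′)
open import Data.Vec.Relation.Binary.Pointwise.Extensional using (ext; Pointwise-≡⇒≡)
open import Function using (_∘_)
open import Relation.Binary.PropositionalEquality
open import Relation.Nullary using (¬_; Dec; yes; no; does; _because_; _×-dec_; ¬?)
open import Relation.Nullary.Decidable using (⌊_⌋; dec-true; dec-false; decidable-stable)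
open import Relation.Unary using (Decidable)

open import Defs

neg-involutive : ∀ a → neg (neg a) ≡ a
neg-involutive minus = refl
neg-involutive zer   = refl
neg-involutive plus  = refl

neg-nonzero : ∀ {a} → a ≢ zer → neg a ≢ zer
neg-nonzero {minus} _ ()
neg-nonzero {zer}   a≢0 = ⊥-elim (a≢0 refl)
neg-nonzero {plus}  _ ()

neg-≢ : ∀ {a} → a ≢ zer → neg a ≢ a
neg-≢ {minus} _ ()
neg-≢ {zer}   a≢0 = ⊥-elim (a≢0 refl)
neg-≢ {plus}  _ ()

≢⇒≡neg : ∀ {a b} → a ≢ zer → b ≢ zer → a ≢ b → a ≡ neg b
≢⇒≡neg {minus} {minus} _ _ a≢b = ⊥-elim (a≢b refl)
≢⇒≡neg {minus} {plus}  _ _ _   = refl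
≢⇒≡neg {plus}  {minus} _ _ _   = refl
≢⇒≡neg {plus}  {plus}  _ _ a≢b = ⊥-elim (a≢b refl)
≢⇒≡neg {zer}           a≢0 _ _ = ⊥-elim (a≢0 refl)
≢⇒≡neg {_}     {zer}   _ b≢0 _ = ⊥-elim (b≢0 refl)

∘ₛ-nonzeroˡ : ∀ {a} b → a ≢ zer → a ∘ₛ b ≡ a
∘ₛ-nonzeroˡ {minus} _ _   = refl
∘ₛ-nonzeroˡ {zer}   _ a≢0 = ⊥-elim (a≢0 refl)
∘ₛ-nonzeroˡ {plus}  _ _   = refl

∘ₛ-nonzeroʳ : ∀ a {b} → b ≢ zer → a ∘ₛ b ≢ zer
∘ₛ-nonzeroʳ minus _ ()
∘ₛ-nonzeroʳ zer   b≢0 = b≢0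
∘ₛ-nonzeroʳ plus  _ ()

≢∧≢neg⇒zer : ∀ {z t} → t ≢ zer → z ≢ t → z ≢ neg t → z ≡ zer
≢∧≢neg⇒zer {zer}            _   _    _     = refl
≢∧≢neg⇒zer {minus} {minus}  _   z≢t  _     = ⊥-elim (z≢t refl)
≢∧≢neg⇒zer {minus} {plus}   _   _    z≢-t  = ⊥-elim (z≢-t refl)
≢∧≢neg⇒zer {plus}  {plus}   _   z≢t  _     = ⊥-elim (z≢t refl)
≢∧≢neg⇒zer {plus}  {minus}  _   _    z≢-t  = ⊥-elim (z≢-t refl)
≢∧≢neg⇒zer {minus} {zer}    t≢0 _    _     = ⊥-elim (t≢0 refl)
≢∧≢neg⇒zer {plus}  {zer}    t≢0 _    _     = ⊥-elim (t≢0 refl)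

∘ₛ-nonreversing : ∀ {a t} → t ≢ zer → a ≢ neg t → a ∘ₛ t ≡ t
∘ₛ-nonreversing {zer}            _   _    = refl
∘ₛ-nonreversing {minus} {minus}  _   _    = refl
∘ₛ-nonreversing {plus}  {plus}   _   _    = refl
∘ₛ-nonreversing {minus} {plus}   _   a≢-t = ⊥-elim (a≢-t refl)
∘ₛ-nonreversing {plus}  {minus}  _   a≢-t = ⊥-elim (a≢-t refl)
∘ₛ-nonreversing {minus} {zer}    t≢0 _    = ⊥-elim (t≢0 refl)
∘ₛ-nonreversing {plus}  {zer}    t≢0 _    = ⊥-elim (t≢0 refl)

reorientSign-involutive : ∀ r a → reorientSign r (reorientSign r a) ≡ a
reorientSign-involutive true  a = neg-involutive a
reorientSign-involutive false a = refl

reorientSign-neg : ∀ r a → reorientSign r (neg a) ≡ neg (reorientSign r a)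
reorientSign-neg true  a = refl
reorientSign-neg false a = refl

reorientSign-∘ₛ : ∀ r a b → reorientSign r (a ∘ₛ b) ≡ reorientSign r a ∘ₛ reorientSign r b
reorientSign-∘ₛ false _     _ = refl
reorientSign-∘ₛ true  minus _ = refl
reorientSign-∘ₛ true  zer   _ = refl
reorientSign-∘ₛ true  plus  _ = refl

reorientSign-zer : ∀ r → reorientSign r zer ≡ zer
reorientSign-zer true  = refl
reorientSign-zer false = refl

reorientSign-nonzero : ∀ r {a} → a ≢ zer → reorientSign r a ≢ zer
reorientSign-nonzero false a≢0 = a≢0
reorientSign-nonzero true  a≢0 = neg-nonzero a≢0

neg-reorientSign : ∀ r a → neg (reorientSign r a) ≡ reorientSign (not r) a
neg-reorientSign true  a = neg-involutive a
neg-reorientSign false a = refl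

reorientSign-injectiveˡ : ∀ {r s a} → a ≢ zer → reorientSign r a ≡ reorientSign s a → r ≡ s
reorientSign-injectiveˡ {true}  {true}  _   _  = refl
reorientSign-injectiveˡ {false} {false} _   _  = refl
reorientSign-injectiveˡ {true}  {false} a≢0 eq = ⊥-elim (neg-≢ a≢0 eq)
reorientSign-injectiveˡ {false} {true}  a≢0 eq = ⊥-elim (neg-≢ a≢0 (sym eq))

reorientSign-injectiveʳ : ∀ r {a b} → reorientSign r a ≡ reorientSign r b → a ≡ b
reorientSign-injectiveʳ r {a} {b} eq = begin
  a                                  ≡⟨ sym (reorientSign-involutive r a) ⟩
  reorientSign r (reorientSign r a)  ≡⟨ cong (reorientSign r) eq ⟩
  reorientSign r (reorientSign r b)  ≡⟨ reorientSign-involutive r b ⟩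
  b                                  ∎
  where open ≡-Reasoning

isPlus-reorient-minus : ∀ b → does (reorientSign b minus ≟ₛ plus) ≡ b
isPlus-reorient-minus true  = refl
isPlus-reorient-minus false = refl

isPlus-reorient-plus : ∀ b → does (reorientSign b plus ≟ₛ plus) ≡ not b
isPlus-reorient-plus true  = refl
isPlus-reorient-plus false = refl

reorientSign-xor : ∀ r s a → reorientSign r (reorientSign s a) ≡ reorientSign (r xor s) a
reorientSign-xor true  s a = neg-reorientSign s a
reorientSign-xor false s a = refl

reorientSign-separates : ∀ r {a b} → a ≢ zer × a ≡ neg b →
                         reorientSign r a ≢ zer × reorientSign r a ≡ neg (reorientSign r b)
reorientSign-separates r (a≢0 , a≡-b) =
  reorientSign-nonzero r a≢0 , trans (cong (reorientSign r) a≡-b) (reorientSign-neg r _)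

-- The product a · t: the sign of a measured against the orientation t (junk when t = 0).
relative : Sign → Sign → Sign
relative a t = reorientSign (does (t ≟ₛ minus)) a

relative-negˡ : ∀ a t → relative (neg a) t ≡ neg (relative a t)
relative-negˡ a t = reorientSign-neg (does (t ≟ₛ minus)) a

relative-negʳ : ∀ a {t} → t ≢ zer → relative a (neg t) ≡ neg (relative a t)
relative-negʳ a {minus} _   = sym (neg-involutive a)
relative-negʳ a {zer}   t≢0 = ⊥-elim (t≢0 refl)
relative-negʳ a {plus}  _   = refl

relative≡minus⇒reverses : ∀ {a t} → t ≢ zer → relative a t ≡ minus → a ≡ neg t
relative≡minus⇒reverses {minus} {minus} _   ()
relative≡minus⇒reverses {zer}   {minus} _   ()
relative≡minus⇒reverses {plus}  {minus} _   _   = refl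
relative≡minus⇒reverses {_}     {zer}   t≢0 _   = ⊥-elim (t≢0 refl)
relative≡minus⇒reverses {_}     {plus}  _   a≡- = a≡-

reverses⇒relative≡minus : ∀ {a t} → t ≢ zer → a ≡ neg t → relative a t ≡ minus
reverses⇒relative≡minus {t = minus} _   refl = refl
reverses⇒relative≡minus {t = zer}   t≢0 _    = ⊥-elim (t≢0 refl)
reverses⇒relative≡minus {t = plus}  _   refl = refl

OneMinus : Sign → Sign → Set
OneMinus u v = (u ≡ minus × v ≢ minus) ⊎ (v ≡ minus × u ≢ minus)

oneMinus : ∀ {u v} → u ≢ v → OneMinus u v ⊎ OneMinus (neg u) (neg v)
oneMinus {minus} {minus} u≢v = ⊥-elim (u≢v refl)
oneMinus {minus} {zer}   _   = inj₁ (inj₁ (refl , λ ()))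
oneMinus {minus} {plus}  _   = inj₁ (inj₁ (refl , λ ()))
oneMinus {zer}   {minus} _   = inj₁ (inj₂ (refl , λ ()))
oneMinus {zer}   {zer}   u≢v = ⊥-elim (u≢v refl)
oneMinus {zer}   {plus}  _   = inj₂ (inj₂ (refl , λ ()))
oneMinus {plus}  {minus} _   = inj₁ (inj₂ (refl , λ ()))
oneMinus {plus}  {zer}   _   = inj₂ (inj₁ (refl , λ ()))
oneMinus {plus}  {plus}  u≢v = ⊥-elim (u≢v refl)

FullSupport : ∀ {m} → SignVec m → Set
FullSupport X = ∀ e → lookup X e ≢ zer

lookup-negVec : ∀ {m} (X : SignVec m) e → lookup (negVec X) e ≡ neg (lookup X e)
lookup-negVec X e = lookup-map e neg X

lookup-∘ᵥ : ∀ {m} (X Y : SignVec m) e → lookup (X ∘ᵥ Y) e ≡ lookup X e ∘ₛ lookup Y e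
lookup-∘ᵥ X Y e = lookup-zipWith _∘ₛ_ e X Y

lookup-reorient : ∀ {m} A (X : SignVec m) e → lookup (reorient A X) e ≡ reorientSign (A e) (lookup X e)
lookup-reorient A X e = lookup∘tabulate _ e

signVec-ext : ∀ {m} {X Y : SignVec m} → (∀ e → lookup X e ≡ lookup Y e) → X ≡ Y
signVec-ext X≗Y = Pointwise-≡⇒≡ (ext X≗Y)

negVec-fullSupport : ∀ {m} (X : SignVec m) → FullSupport X → FullSupport (negVec X)
negVec-fullSupport X full e = neg-nonzero (full e) ∘ trans (sym (lookup-negVec X e))

flipAt : ∀ {m} → Fin m → SignVec m → SignVec m
flipAt e X = X [ e ]%= neg

lookup-flipAt : ∀ {m} e (X : SignVec m) → lookup (flipAt e X) e ≡ neg (lookup X e)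
lookup-flipAt e X = lookup∘updateAt e X

lookup-flipAt-other : ∀ {m} {e x} (X : SignVec m) → x ≢ e → lookup (flipAt e X) x ≡ lookup X x
lookup-flipAt-other {e = e} {x} X x≢e = lookup∘updateAt′ x e x≢e X

⟦_⟧ : Bool → ℕ
⟦ true  ⟧ = 1
⟦ false ⟧ = 0

⟦does⟧-mono : ∀ {A B : Set} (A? : Dec A) (B? : Dec B) → (A → B) → ⟦ does A? ⟧ ≤ ⟦ does B? ⟧
⟦does⟧-mono A? B? A⇒B with A? | B?
... | yes a | no ¬b = ⊥-elim (¬b (A⇒B a))
... | yes _ | yes _ = ≤-refl
... | no _  | _     = z≤n

count : ∀ {n} {P : Fin n → Set} → Decidable P → ℕ
count {zero}  P? = 0
count {suc n} P? = ⟦ does (P? zero) ⟧ + count (P? ∘ suc)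

count-cong : ∀ {n} {P Q : Fin n → Set} (P? : Decidable P) (Q? : Decidable Q) →
             (∀ e → does (P? e) ≡ does (Q? e)) → count P? ≡ count Q?
count-cong {zero}  P? Q? P≗Q = refl
count-cong {suc n} P? Q? P≗Q =
  cong₂ _+_ (cong ⟦_⟧ (P≗Q zero)) (count-cong (P? ∘ suc) (Q? ∘ suc) (P≗Q ∘ suc))

count-≤ : ∀ {n} {P Q : Fin n → Set} (P? : Decidable P) (Q? : Decidable Q) →
          (∀ {e} → P e → Q e) → count P? ≤ count Q?
count-≤ {zero}  P? Q? P⇒Q = z≤n
count-≤ {suc n} P? Q? P⇒Q =
  +-mono-≤ (⟦does⟧-mono (P? zero) (Q? zero) P⇒Q) (count-≤ (P? ∘ suc) (Q? ∘ suc) P⇒Q)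

count-< : ∀ {n} {P Q : Fin n → Set} (P? : Decidable P) (Q? : Decidable Q) →
          (∀ {e} → P e → Q e) → ∀ {w} → Q w → ¬ P w → count P? < count Q?
count-< {suc n} P? Q? P⇒Q {zero} Qw ¬Pw
  rewrite dec-false (P? zero) ¬Pw | dec-true (Q? zero) Qw = s≤s (count-≤ (P? ∘ suc) (Q? ∘ suc) P⇒Q)
count-< {suc n} P? Q? P⇒Q {suc w} Qw ¬Pw =
  +-mono-≤-< (⟦does⟧-mono (P? zero) (Q? zero) P⇒Q) (count-< (P? ∘ suc) (Q? ∘ suc) P⇒Q Qw ¬Pw)

count-≤-size : ∀ {n} {P : Fin n → Set} (P? : Decidable P) → count P? ≤ n
count-≤-size {zero}  P? = z≤n
count-≤-size {suc n} P? =
  +-mono-≤ (⟦does⟧-mono (P? zero) (yes tt) (λ _ → tt)) (count-≤-size (P? ∘ suc))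

count-all : ∀ {n} {P : Fin n → Set} (P? : Decidable P) → (∀ e → P e) → count P? ≡ n
count-all {zero}  P? all = refl
count-all {suc n} P? all rewrite dec-true (P? zero) (all zero) =
  cong suc (count-all (P? ∘ suc) (all ∘ suc))

count-none : ∀ {n} {P : Fin n → Set} (P? : Decidable P) → (∀ e → ¬ P e) → count P? ≡ 0
count-none {zero}  P? none = refl
count-none {suc n} P? none rewrite dec-false (P? zero) (none zero) =
  count-none (P? ∘ suc) (none ∘ suc)

count≡0⇒¬ : ∀ {n} {P : Fin n → Set} (P? : Decidable P) → count P? ≡ 0 → ∀ e → ¬ P e
count≡0⇒¬ {suc n} P? c≡0 zero    Pe rewrite dec-true (P? zero) Pe = 1+n≢0 c≡0
count≡0⇒¬ {suc n} P? c≡0 (suc e) Pe =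
  count≡0⇒¬ (P? ∘ suc) (m+n≡0⇒n≡0 ⟦ does (P? zero) ⟧ c≡0) e Pe

count>0⇒∃ : ∀ {n} {P : Fin n → Set} (P? : Decidable P) → 0 < count P? → ∃ P
count>0⇒∃ P? c>0 with any? P?
... | yes ∃P = ∃P
... | no ¬∃P = ⊥-elim (<⇒≢ c>0 (sym (count-none P? (λ e Pe → ¬∃P (e , Pe)))))

count-remove : ∀ {n} {P Q : Fin n → Set} (P? : Decidable P) (Q? : Decidable Q) f →
               (∀ e → e ≢ f → does (P? e) ≡ does (Q? e)) → ¬ Q f →
               count P? ≡ ⟦ does (P? f) ⟧ + count Q?
count-remove {suc n} P? Q? zero P≗Q ¬Qf rewrite dec-false (Q? zero) ¬Qf =
  cong (⟦ does (P? zero) ⟧ +_) (count-cong (P? ∘ suc) (Q? ∘ suc) (λ e → P≗Q (suc e) λ ()))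
count-remove {suc n} P? Q? (suc f) P≗Q ¬Qf = begin
  ⟦ does (P? zero) ⟧ + count (P? ∘ suc)
    ≡⟨ cong₂ _+_ (cong ⟦_⟧ (P≗Q zero λ ()))
                 (count-remove (P? ∘ suc) (Q? ∘ suc) f
                               (λ e e≢f → P≗Q (suc e) (e≢f ∘ Fin-suc-injective)) ¬Qf) ⟩
  ⟦ does (Q? zero) ⟧ + (⟦ does (P? (suc f)) ⟧ + count (Q? ∘ suc))
    ≡⟨ x∙yz≈y∙xz ⟦ does (Q? zero) ⟧ ⟦ does (P? (suc f)) ⟧ _ ⟩
  ⟦ does (P? (suc f)) ⟧ + (⟦ does (Q? zero) ⟧ + count (Q? ∘ suc)) ∎
  where open ≡-Reasoning

does-suc-≤ : ∀ a b → does (suc a ≤? suc b) ≡ does (a ≤? b)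
does-suc-≤ a b with a ≤? b
... | yes a≤b = trans (dec-true (suc a ≤? suc b) (s≤s a≤b)) (sym (dec-true (a ≤? b) a≤b))
... | no  a≰b = trans (dec-false (suc a ≤? suc b) (a≰b ∘ ≤-pred)) (sym (dec-false (a ≤? b) a≰b))

count-below : ∀ {m s} → s ≤ m → count {m} (λ e → suc (toℕ e) ≤? s) ≡ s
count-below {zero}  {zero}  _       = refl
count-below {suc m} {zero}  _       = count-none {suc m} (λ e → suc (toℕ e) ≤? 0) (λ _ ())
count-below {suc m} {suc s} (s≤s s≤m) =
  cong suc (trans (count-cong {m} (λ e → suc (suc (toℕ e)) ≤? suc s) (λ e → suc (toℕ e) ≤? s)
                                  (λ e → does-suc-≤ (suc (toℕ e)) s))
                  (count-below {m} s≤m))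

⌊⌋≡does : ∀ {A : Set} (A? : Dec A) → ⌊ A? ⌋ ≡ does A?
⌊⌋≡does (true  because _) = refl
⌊⌋≡does (false because _) = refl

countRange : (ℕ → Bool) → ℕ → ℕ → ℕ
countRange p a zero    = 0
countRange p a (suc n) = ⟦ p a ⟧ + countRange p (suc a) n

InRange : ℕ → ℕ → ℕ → Set
InRange a n j = a ≤ j × j < a + n

inRange-head : ∀ a n → InRange a (suc n) a
inRange-head a n = ≤-refl , m<m+n a z<s

inRange-tail : ∀ {a n j} → InRange (suc a) n j → InRange a (suc n) j
inRange-tail {a} {n} {j} (a<j , j<) = <⇒≤ a<j , subst (j <_) (sym (+-suc a n)) j<

countRange-cong : ∀ {p q} a n → (∀ {j} → InRange a n j → p j ≡ q j) →
                  countRange p a n ≡ countRange q a n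
countRange-cong a zero    p≗q = refl
countRange-cong a (suc n) p≗q =
  cong₂ _+_ (cong ⟦_⟧ (p≗q (inRange-head a n))) (countRange-cong (suc a) n (p≗q ∘ inRange-tail))

countRange-++ : ∀ p a n₁ n₂ → countRange p a (n₁ + n₂) ≡ countRange p a n₁ + countRange p (a + n₁) n₂
countRange-++ p a zero     n₂ = cong (λ b → countRange p b n₂) (sym (+-identityʳ a))
countRange-++ p a (suc n₁) n₂ = begin
  ⟦ p a ⟧ + countRange p (suc a) (n₁ + n₂)
    ≡⟨ cong (⟦ p a ⟧ +_) (countRange-++ p (suc a) n₁ n₂) ⟩
  ⟦ p a ⟧ + (countRange p (suc a) n₁ + countRange p (suc a + n₁) n₂)
    ≡⟨ sym (+-assoc ⟦ p a ⟧ _ _) ⟩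
  countRange p a (suc n₁) + countRange p (suc a + n₁) n₂
    ≡⟨ cong (λ b → countRange p a (suc n₁) + countRange p b n₂) (sym (+-suc a n₁)) ⟩
  countRange p a (suc n₁) + countRange p (a + suc n₁) n₂ ∎
  where open ≡-Reasoning

countRange-shift : ∀ p c a n → countRange (λ j → p (j + c)) a n ≡ countRange p (a + c) n
countRange-shift p c a zero    = refl
countRange-shift p c a (suc n) = cong (⟦ p (a + c) ⟧ +_) (countRange-shift p c (suc a) n)

countRange-suc : ∀ p a n → countRange (p ∘ suc) a n ≡ countRange p (suc a) n
countRange-suc p a zero    = refl
countRange-suc p a (suc n) = cong (⟦ p (suc a) ⟧ +_) (countRange-suc p (suc a) n)

countRange-snoc : ∀ p a n → countRange p a (suc n) ≡ countRange p a n + ⟦ p (a + n) ⟧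
countRange-snoc p a zero    = trans (+-identityʳ ⟦ p a ⟧) (cong (λ b → ⟦ p b ⟧) (sym (+-identityʳ a)))
countRange-snoc p a (suc n) = begin
  ⟦ p a ⟧ + countRange p (suc a) (suc n)
    ≡⟨ cong (⟦ p a ⟧ +_) (countRange-snoc p (suc a) n) ⟩
  ⟦ p a ⟧ + (countRange p (suc a) n + ⟦ p (suc a + n) ⟧)
    ≡⟨ sym (+-assoc ⟦ p a ⟧ _ _) ⟩
  countRange p a (suc n) + ⟦ p (suc a + n) ⟧
    ≡⟨ cong (λ b → countRange p a (suc n) + ⟦ p b ⟧) (sym (+-suc a n)) ⟩
  countRange p a (suc n) + ⟦ p (a + suc n) ⟧ ∎
  where open ≡-Reasoning

countRange-true : ∀ a n → countRange (λ _ → true) a n ≡ n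
countRange-true a zero    = refl
countRange-true a (suc n) = cong suc (countRange-true (suc a) n)

countRange-∧-true : ∀ (p : ℕ → Bool) {q : ℕ → Bool} a n → (∀ {j} → InRange a n j → q j ≡ true) →
                    countRange (λ j → p j ∧ q j) a n ≡ countRange p a n
countRange-∧-true p a n q≡true =
  countRange-cong a n (λ {j} j∈ → trans (cong (p j ∧_) (q≡true j∈)) (∧-identityʳ (p j)))

countRange-∧-false : ∀ (p : ℕ → Bool) {q : ℕ → Bool} a n → (∀ {j} → InRange a n j → q j ≡ false) →
                     countRange (λ j → p j ∧ q j) a n ≡ 0
countRange-∧-false p {q} a zero    q≡false = refl
countRange-∧-false p {q} a (suc n) q≡false rewrite q≡false (inRange-head a n) | ∧-zeroʳ (p a) =
  countRange-∧-false p (suc a) n (q≡false ∘ inRange-tail)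

countRange-∧-≤ʳ : ∀ (p q : ℕ → Bool) a n → countRange (λ j → p j ∧ q j) a n ≤ countRange q a n
countRange-∧-≤ʳ p q a zero    = z≤n
countRange-∧-≤ʳ p q a (suc n) = +-mono-≤ (⟦∧⟧-≤ʳ (p a) (q a)) (countRange-∧-≤ʳ p q (suc a) n)
  where
  ⟦∧⟧-≤ʳ : ∀ x y → ⟦ x ∧ y ⟧ ≤ ⟦ y ⟧
  ⟦∧⟧-≤ʳ true  y = ≤-refl
  ⟦∧⟧-≤ʳ false y = z≤n

countRange-disjoint : ∀ (p q : ℕ → Bool) a n → (∀ j → ⟦ p j ⟧ + ⟦ q j ⟧ ≤ 1) →
                      countRange p a n + countRange q a n ≤ n
countRange-disjoint p q a zero    disjoint = z≤n
countRange-disjoint p q a (suc n) disjoint = begin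
  (⟦ p a ⟧ + countRange p (suc a) n) + (⟦ q a ⟧ + countRange q (suc a) n)
    ≡⟨ interchange ⟦ p a ⟧ _ ⟦ q a ⟧ _ ⟩
  (⟦ p a ⟧ + ⟦ q a ⟧) + (countRange p (suc a) n + countRange q (suc a) n)
    ≤⟨ +-mono-≤ (disjoint a) (countRange-disjoint p q (suc a) n disjoint) ⟩
  suc n ∎
  where open ≤-Reasoning

selectRange : ∀ {A : Set} → (ℕ → Bool) → (ℕ → A) → ℕ → ℕ → List A
selectRange p f a zero    = []
selectRange p f a (suc n) with p a
... | true  = f a ∷ selectRange p f (suc a) n
... | false = selectRange p f (suc a) n

module _ {A : Set} (p : ℕ → Bool) (f : ℕ → A) where

  length-selectRange : ∀ a n → length (selectRange p f a n) ≡ countRange p a n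
  length-selectRange a zero = refl
  length-selectRange a (suc n) with p a
  ... | true  = cong suc (length-selectRange (suc a) n)
  ... | false = length-selectRange (suc a) n

  length-filter-selectRange : ∀ {P : A → Set} (P? : Decidable P) a n →
    length (filter P? (selectRange p f a n)) ≡ countRange (λ j → p j ∧ does (P? (f j))) a n
  length-filter-selectRange P? a zero = refl
  length-filter-selectRange P? a (suc n) with p a
  ... | false = length-filter-selectRange P? (suc a) n
  ... | true with P? (f a)
  ...   | yes _ = cong suc (length-filter-selectRange P? (suc a) n)
  ...   | no  _ = length-filter-selectRange P? (suc a) n

  selectRange-all : ∀ {P : A → Set} a n → (∀ {j} → InRange a n j → P (f j)) →
                    All P (selectRange p f a n)
  selectRange-all a zero    Pf = []
  selectRange-all a (suc n) Pf with p a
  ... | true  = Pf (inRange-head a n) ∷ selectRange-all (suc a) n (Pf ∘ inRange-tail)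
  ... | false = selectRange-all (suc a) n (Pf ∘ inRange-tail)

  selectRange-unique : ∀ a n → (∀ {i j} → i < j → InRange a n i → InRange a n j → f i ≢ f j) →
                       Unique (selectRange p f a n)
  selectRange-unique a zero    f-inj = []
  selectRange-unique a (suc n) f-inj with p a
  ... | true  = selectRange-all (suc a) n (λ j∈ → f-inj (proj₁ j∈) (inRange-head a n) (inRange-tail j∈))
              ∷ selectRange-unique (suc a) n (λ i<j i∈ j∈ → f-inj i<j (inRange-tail i∈) (inRange-tail j∈))
  ... | false = selectRange-unique (suc a) n (λ i<j i∈ j∈ → f-inj i<j (inRange-tail i∈) (inRange-tail j∈))

module Window (m : ℕ) where

  inWindow : ℕ → ℕ → Bool
  inWindow p j = does (p ≤? j) ∧ does (j <? p + m)

  outsideWindow : (ℕ → Bool) → ℕ → ℕ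
  outsideWindow q p = countRange q 0 p + countRange q (p + m) (m ∸ p)

  inWindow-inside : ∀ {p j} → p ≤ j → j < p + m → inWindow p j ≡ true
  inWindow-inside {p} {j} p≤j j<p+m rewrite dec-true (p ≤? j) p≤j | dec-true (j <? p + m) j<p+m = refl

  inWindow-before : ∀ {p j} → j < p → inWindow p j ≡ false
  inWindow-before {p} {j} j<p rewrite dec-false (p ≤? j) (<⇒≱ j<p) = refl

  inWindow-after : ∀ {p j} → p + m ≤ j → inWindow p j ≡ false
  inWindow-after {p} {j} p+m≤j rewrite dec-false (j <? p + m) (≤⇒≯ p+m≤j) = ∧-zeroʳ _

  countRange-window : ∀ q {p} → p ≤ m → countRange q 0 (m + m) ≡ countRange q p m + outsideWindow q p
  countRange-window q {p} p≤m = begin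
    countRange q 0 (m + m)
      ≡⟨ cong (countRange q 0) (sym split) ⟩
    countRange q 0 (p + (m + (m ∸ p)))
      ≡⟨ countRange-++ q 0 p _ ⟩
    countRange q 0 p + countRange q p (m + (m ∸ p))
      ≡⟨ cong (countRange q 0 p +_) (countRange-++ q p m (m ∸ p)) ⟩
    countRange q 0 p + (countRange q p m + countRange q (p + m) (m ∸ p))
      ≡⟨ x∙yz≈y∙xz (countRange q 0 p) (countRange q p m) _ ⟩
    countRange q p m + outsideWindow q p ∎
    where
    open ≡-Reasoning
    split : p + (m + (m ∸ p)) ≡ m + m
    split = begin
      p + (m + (m ∸ p)) ≡⟨ x∙yz≈y∙xz p m (m ∸ p) ⟩
      m + (p + (m ∸ p)) ≡⟨ cong (m +_) (m+[n∸m]≡n p≤m) ⟩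
      m + m             ∎

  countRange-inWindow : ∀ q {p} → p ≤ m →
                        countRange (λ j → q j ∧ inWindow p j) 0 (m + m) ≡ countRange q p m
  countRange-inWindow q {p} p≤m = begin
    countRange (λ j → q j ∧ inWindow p j) 0 (m + m)
      ≡⟨ countRange-window _ p≤m ⟩
    countRange (λ j → q j ∧ inWindow p j) p m + outsideWindow (λ j → q j ∧ inWindow p j) p
      ≡⟨ cong₂ _+_ (countRange-∧-true q p m (λ (p≤j , j<p+m) → inWindow-inside p≤j j<p+m))
                   (cong₂ _+_ (countRange-∧-false q 0 p (λ (_ , j<p) → inWindow-before j<p))
                              (countRange-∧-false q (p + m) (m ∸ p) (λ (p+m≤j , _) → inWindow-after p+m≤j))) ⟩
    countRange q p m + 0
      ≡⟨ +-identityʳ _ ⟩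
    countRange q p m ∎
    where open ≡-Reasoning

  countRange-outsideWindow : ∀ q {p} → p ≤ m →
                             countRange (λ j → q j ∧ not (inWindow p j)) 0 (m + m) ≡ outsideWindow q p
  countRange-outsideWindow q {p} p≤m = begin
    countRange (λ j → q j ∧ not (inWindow p j)) 0 (m + m)
      ≡⟨ countRange-window _ p≤m ⟩
    countRange (λ j → q j ∧ not (inWindow p j)) p m + outsideWindow (λ j → q j ∧ not (inWindow p j)) p
      ≡⟨ cong₂ _+_ (countRange-∧-false q p m (λ (p≤j , j<p+m) → cong not (inWindow-inside p≤j j<p+m)))
                   (cong₂ _+_ (countRange-∧-true q 0 p (λ (_ , j<p) → cong not (inWindow-before j<p)))
                              (countRange-∧-true q (p + m) (m ∸ p)
                                                 (λ (p+m≤j , _) → cong not (inWindow-after p+m≤j)))) ⟩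
    outsideWindow q p ∎
    where open ≡-Reasoning

  windowEndingAt : ∀ {x} → 0 < m → m ≤ x → x < m + m →
                   1 ≤ suc (x ∸ m) × suc (x ∸ m) ≤ m × inWindow (suc (x ∸ m)) x ≡ true
                   × (∀ {y} → x < y → inWindow (suc (x ∸ m)) y ≡ false)
  windowEndingAt {x} 0<m m≤x x<2m =
    s≤s z≤n ,
    +-cancelʳ-< m (x ∸ m) m (subst (_< m + m) (sym (m∸n+n≡m m≤x)) x<2m) ,
    inWindow-inside (∸-monoʳ-< 0<m m≤x) (s≤s (≤-reflexive (sym (m∸n+n≡m m≤x)))) ,
    λ {y} x<y → inWindow-after (subst (_≤ y) (cong suc (sym (m∸n+n≡m m≤x))) x<y)

  separatingRank : 0 < m → ∀ {i j} → i < j → j < m + m →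
                   ∃[ p ] (1 ≤ p × p ≤ m × inWindow p i ≢ inWindow p j)
  separatingRank 0<m {i} {j} i<j j<2m with m ≤? i | i + m ≤? j
  ... | yes m≤i | _ =
    let 1≤p , p≤m , in-i , out = windowEndingAt 0<m m≤i (<-trans i<j j<2m) in
    suc (i ∸ m) , 1≤p , p≤m , subst₂ _≢_ (sym in-i) (sym (out i<j)) (λ ())
  ... | no _ | yes i+m≤j =
    let 1≤p , p≤m , in-j , _ = windowEndingAt 0<m (≤-trans (m≤n+m m i) i+m≤j) j<2m in
    suc (j ∸ m) , 1≤p , p≤m ,
    subst₂ _≢_ (sym (inWindow-before (s≤s (m+n≤o⇒m≤o∸n i i+m≤j)))) (sym in-j) (λ ())
  ... | no m≰i | no i+m≰j =
    suc i , s≤s z≤n , ≰⇒> m≰i ,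
    subst₂ _≢_ (sym (inWindow-before (n<1+n i))) (sym (inWindow-inside i<j (m<n⇒m<1+n (≰⇒> i+m≰j)))) (λ ())

balanced⇒odd : ∀ b P V → P + ⟦ not b ⟧ ≡ V + ⟦ b ⟧ → ∃[ x ] (P + V ≡ 1 + 2 * x × x ≤ V)
balanced⇒odd true P V eq = V , (begin
  P + V      ≡⟨ cong (_+ V) P≡1+V ⟩
  suc V + V  ≡⟨ cong (λ v → suc (V + v)) (sym (+-identityʳ V)) ⟩
  1 + 2 * V  ∎) , ≤-refl
  where
  open ≡-Reasoning
  P≡1+V : P ≡ suc V
  P≡1+V = trans (sym (+-identityʳ P)) (trans eq (+-comm V 1))
balanced⇒odd false P V eq = P , (begin
  P + V        ≡⟨ cong (P +_) V≡1+P ⟩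
  P + suc P    ≡⟨ +-suc P P ⟩
  suc (P + P)  ≡⟨ cong (λ v → suc (P + v)) (sym (+-identityʳ P)) ⟩
  1 + 2 * P    ∎) , ≤-trans (n≤1+n P) (≤-reflexive (sym V≡1+P))
  where
  open ≡-Reasoning
  V≡1+P : V ≡ suc P
  V≡1+P = trans (sym (+-identityʳ V)) (trans (sym eq) (+-comm P 1))

m+1≡n⇒m+n<2*n : ∀ {m n} → m + 1 ≡ n → m + n < 2 * n
m+1≡n⇒m+n<2*n {m} {n} m+1≡n =
  subst (m + n <_) (cong (n +_) (sym (+-identityʳ n))) (+-monoˡ-< n (subst (m <_) m+1≡n (m<m+n m z<s)))

odd≤even⇒≤pred : ∀ {k m} x → k ≡ 1 + 2 * x → k ≤ m → m % 2 ≡ 0 → k ≤ m ∸ 1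
odd≤even⇒≤pred {k} {m} x k≡1+2x k≤m m-even = <⇒≤pred (≤∧≢⇒< k≤m k≢m)
  where
  k≢m : k ≢ m
  k≢m k≡m = 1+n≢0 (begin
    1                  ≡⟨ sym ([m+kn]%n≡m%n 1 x 2) ⟩
    (1 + x * 2) % 2    ≡⟨ cong (λ y → (1 + y) % 2) (*-comm x 2) ⟩
    (1 + 2 * x) % 2    ≡⟨ cong (_% 2) (trans (sym k≡1+2x) k≡m) ⟩
    m % 2              ≡⟨ m-even ⟩
    0                  ∎)
    where open ≡-Reasoning

-- Peaks of an antiperiodic Boolean sequence

module Peaks (rise : ℕ → Bool) where

  peak valley : ℕ → Bool
  peak   j = rise j ∧ not (rise (suc j))
  valley j = not (rise j) ∧ rise (suc j)

  peak+valley≤1 : ∀ j → ⟦ peak j ⟧ + ⟦ valley j ⟧ ≤ 1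
  peak+valley≤1 j with rise j | rise (suc j)
  ... | true  | true  = z≤n
  ... | true  | false = ≤-refl
  ... | false | true  = ≤-refl
  ... | false | false = z≤n

  telescope : ∀ a n → countRange peak a n + ⟦ rise (a + n) ⟧ ≡ countRange valley a n + ⟦ rise a ⟧
  telescope a zero    = cong ⟦_⟧ (cong rise (+-identityʳ a))
  telescope a (suc n) = begin
    (⟦ peak a ⟧ + countRange peak (suc a) n) + ⟦ rise (a + suc n) ⟧
      ≡⟨ +-assoc ⟦ peak a ⟧ _ _ ⟩
    ⟦ peak a ⟧ + (countRange peak (suc a) n + ⟦ rise (a + suc n) ⟧)
      ≡⟨ cong (λ k → ⟦ peak a ⟧ + (countRange peak (suc a) n + ⟦ rise k ⟧)) (+-suc a n) ⟩
    ⟦ peak a ⟧ + (countRange peak (suc a) n + ⟦ rise (suc a + n) ⟧)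
      ≡⟨ cong (⟦ peak a ⟧ +_) (telescope (suc a) n) ⟩
    ⟦ peak a ⟧ + (countRange valley (suc a) n + ⟦ rise (suc a) ⟧)
      ≡⟨ step (rise a) (rise (suc a)) _ ⟩
    (⟦ valley a ⟧ + countRange valley (suc a) n) + ⟦ rise a ⟧ ∎
    where
    open ≡-Reasoning
    step : ∀ x y V → ⟦ x ∧ not y ⟧ + (V + ⟦ y ⟧) ≡ (⟦ not x ∧ y ⟧ + V) + ⟦ x ⟧
    step true  true  V = refl
    step true  false V = trans (cong suc (+-identityʳ V)) (sym (+-comm V 1))
    step false true  V = trans (+-comm V 1) (sym (+-identityʳ (suc V)))
    step false false V = refl

  module Antiperiodic (m : ℕ) (antiperiodic : ∀ {j} → j ≤ m → rise (j + m) ≡ not (rise j)) where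

    open Window m using (outsideWindow)

    peak-+m : ∀ {j} → j < m → peak (j + m) ≡ valley j
    peak-+m {j} j<m
      rewrite antiperiodic (<⇒≤ j<m) | antiperiodic j<m | not-involutive (rise (suc j)) = refl

    valley-+m : ∀ {j} → j < m → valley (j + m) ≡ peak j
    valley-+m {j} j<m
      rewrite antiperiodic (<⇒≤ j<m) | antiperiodic j<m | not-involutive (rise j) = refl

    peaks-halves : countRange peak 0 (m + m) ≡ countRange peak 0 m + countRange valley 0 m
    peaks-halves = begin
      countRange peak 0 (m + m)
        ≡⟨ countRange-++ peak 0 m m ⟩
      countRange peak 0 m + countRange peak m m
        ≡⟨ cong (countRange peak 0 m +_) (sym (countRange-shift peak m 0 m)) ⟩
      countRange peak 0 m + countRange (λ j → peak (j + m)) 0 m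
        ≡⟨ cong (countRange peak 0 m +_) (countRange-cong 0 m (peak-+m ∘ proj₂)) ⟩
      countRange peak 0 m + countRange valley 0 m ∎
      where open ≡-Reasoning

    peaks-≤ : countRange peak 0 (m + m) ≤ m
    peaks-≤ = subst (_≤ m) (sym peaks-halves) (countRange-disjoint peak valley 0 m peak+valley≤1)

    peaks-odd : ∃[ x ] (countRange peak 0 (m + m) ≡ 1 + 2 * x × x ≤ countRange valley 0 m)
    peaks-odd with balanced⇒odd (rise 0) _ _ balance
      where
      balance : countRange peak 0 m + ⟦ not (rise 0) ⟧ ≡ countRange valley 0 m + ⟦ rise 0 ⟧
      balance = subst (λ b → countRange peak 0 m + ⟦ b ⟧ ≡ countRange valley 0 m + ⟦ rise 0 ⟧)
                      (antiperiodic z≤n) (telescope 0 m)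
    ... | x , total≡ , x≤V = x , trans peaks-halves total≡ , x≤V

    peaks-≤-rises : countRange peak 0 (m + m) ≤ 1 + 2 * countRange rise 1 m
    peaks-≤-rises with peaks-odd
    ... | x , total≡ , x≤V = begin
      countRange peak 0 (m + m)  ≡⟨ total≡ ⟩
      1 + 2 * x                  ≤⟨ +-monoʳ-≤ 1 (*-monoʳ-≤ 2 x≤V) ⟩
      1 + 2 * countRange valley 0 m
        ≤⟨ +-monoʳ-≤ 1 (*-monoʳ-≤ 2 (countRange-∧-≤ʳ (not ∘ rise) (rise ∘ suc) 0 m)) ⟩
      1 + 2 * countRange (rise ∘ suc) 0 m ≡⟨ cong (λ c → 1 + 2 * c) (countRange-suc rise 0 m) ⟩
      1 + 2 * countRange rise 1 m   ∎
      where open ≤-Reasoning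

    peaks-window : ∀ {p} → p ≤ m →
                   countRange peak p m + ⟦ not (rise p) ⟧ ≡ outsideWindow peak p + ⟦ rise p ⟧
    peaks-window {p} p≤m = begin
      countRange peak p m + ⟦ not (rise p) ⟧  ≡⟨ cong (λ b → countRange peak p m + ⟦ b ⟧)
                                                      (sym (antiperiodic p≤m)) ⟩
      countRange peak p m + ⟦ rise (p + m) ⟧  ≡⟨ telescope p m ⟩
      countRange valley p m + ⟦ rise p ⟧      ≡⟨ cong (_+ ⟦ rise p ⟧) valleys≡outside ⟩
      outsideWindow peak p + ⟦ rise p ⟧     ∎
      where
      open ≡-Reasoning
      before : countRange peak 0 p ≡ countRange valley m p
      before = trans (countRange-cong 0 p (λ j∈ → sym (valley-+m (≤-trans (proj₂ j∈) p≤m))))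
                     (countRange-shift valley m 0 p)
      after : countRange peak (p + m) (m ∸ p) ≡ countRange valley p (m ∸ p)
      after = trans (sym (countRange-shift peak m p (m ∸ p)))
                    (countRange-cong p (m ∸ p) (λ j∈ → peak-+m (subst (_ <_) (m+[n∸m]≡n p≤m) (proj₂ j∈))))
      valleys≡outside : countRange valley p m ≡ outsideWindow peak p
      valleys≡outside = begin
        countRange valley p m
          ≡⟨ cong (countRange valley p) (sym (m∸n+n≡m p≤m)) ⟩
        countRange valley p ((m ∸ p) + p)
          ≡⟨ countRange-++ valley p (m ∸ p) p ⟩
        countRange valley p (m ∸ p) + countRange valley (p + (m ∸ p)) p
          ≡⟨ cong (λ a → countRange valley p (m ∸ p) + countRange valley a p) (m+[n∸m]≡n p≤m) ⟩
        countRange valley p (m ∸ p) + countRange valley m p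
          ≡⟨ +-comm (countRange valley p (m ∸ p)) _ ⟩
        countRange valley m p + countRange valley p (m ∸ p)
          ≡⟨ sym (cong₂ _+_ before after) ⟩
        outsideWindow peak p ∎

-- Adjacent topes

NoParallelPair : ∀ {m} → Bool → (SignVec m → Set) → Set
NoParallelPair {m} r L =
  ∀ (e f : Fin m) → e ≢ f → ∃[ X ] (L X × lookup X e ≢ reorientSign r (lookup X f))

NoParallel NoAntiparallel : ∀ {m} → (SignVec m → Set) → Set
NoParallel     = NoParallelPair false
NoAntiparallel = NoParallelPair true

fullSupport⇒tope : ∀ {m} {L : SignVec m → Set} {X} → L X → FullSupport X → IsTope L X
fullSupport⇒tope X∈L X-full = X∈L , λ _ _ _ e _ → X-full e

tope⇒fullSupport : ∀ {m} {L : SignVec m → Set} → IsOM m L →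
                   (∀ e → ∃[ T ] (IsTope L T × lookup T e ≢ zer)) → ∀ {T} → IsTope L T → FullSupport T
tope⇒fullSupport om loopFree {T} (T∈L , maximal) f Tf≡0 with loopFree f
... | U , (U∈L , _) , Uf≢0 = maximal (T ∘ᵥ U) (L2 T U T∈L U∈L) T⊆TU f TUf≢0 Tf≡0
  where
  open IsOM om
  T⊆TU : T ⊆supp (T ∘ᵥ U)
  T⊆TU g Tg≢0 = Tg≢0 ∘ trans (sym (∘ₛ-nonzeroˡ _ Tg≢0)) ∘ trans (sym (lookup-∘ᵥ T U g))
  TUf≢0 : lookup (T ∘ᵥ U) f ≢ zer
  TUf≢0 = Uf≢0 ∘ trans (cong (_∘ₛ lookup U f) (sym Tf≡0)) ∘ trans (sym (lookup-∘ᵥ T U f))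

Reverses : ∀ {m} → SignVec m → SignVec m → Fin m → Set
Reverses W T g = lookup W g ≡ neg (lookup T g)

ReversesExactlyOne : ∀ {m} → SignVec m → SignVec m → Fin m → Fin m → Set
ReversesExactlyOne W T e f = (Reverses W T e × ¬ Reverses W T f) ⊎ (Reverses W T f × ¬ Reverses W T e)

Disagree : ∀ {m} → SignVec m → SignVec m → Fin m → Set
Disagree X Y e = lookup X e ≢ lookup Y e

distance : ∀ {m} → SignVec m → SignVec m → ℕ
distance X Y = count (λ e → ¬? (lookup X e ≟ₛ lookup Y e))

module Adjacency {m} {L : SignVec m → Set} (om : IsOM m L)
                 (noParallel : NoParallel L) (noAntiparallel : NoAntiparallel L) where

  open IsOM om

  module _ {T : SignVec m} (T-full : FullSupport T) {e f : Fin m} where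

    private
      Rel : SignVec m → Fin m → Sign
      Rel W g = relative (lookup W g) (lookup T g)

      Rel-negVec : ∀ X g → Rel (negVec X) g ≡ neg (Rel X g)
      Rel-negVec X g =
        trans (cong (λ a → relative a (lookup T g)) (lookup-negVec X g)) (relative-negˡ (lookup X g) (lookup T g))

      fromOneMinus : ∀ {W} → OneMinus (Rel W e) (Rel W f) → ReversesExactlyOne W T e f
      fromOneMinus (inj₁ (e- , ¬f-)) =
        inj₁ (relative≡minus⇒reverses (T-full e) e- , ¬f- ∘ reverses⇒relative≡minus (T-full f))
      fromOneMinus (inj₂ (f- , ¬e-)) =
        inj₂ (relative≡minus⇒reverses (T-full f) f- , ¬e- ∘ reverses⇒relative≡minus (T-full e))

      choose : ∀ {X} → L X → Rel X e ≢ Rel X f → ∃[ W ] (L W × ReversesExactlyOne W T e f)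
      choose {X} X∈L Xe≢Xf with oneMinus Xe≢Xf
      ... | inj₁ one = X , X∈L , fromOneMinus {X} one
      ... | inj₂ one = negVec X , L1 X X∈L ,
                       fromOneMinus {negVec X} (subst₂ OneMinus (sym (Rel-negVec X e)) (sym (Rel-negVec X f)) one)

    -- Simplicity gives X with X(e)·T(e) ≠ X(f)·T(f); then X or −X reverses T at exactly one of e, f.
    separator : e ≢ f → ∃[ W ] (L W × ReversesExactlyOne W T e f)
    separator e≢f with lookup T e ≟ₛ lookup T f
    ... | yes Te≡Tf =
      let X , X∈L , Xe≢Xf = noParallel e f e≢f in
      choose X∈L λ eq → Xe≢Xf (reorientSign-injectiveʳ (does (lookup T f ≟ₛ minus))
                                                          (trans (cong (relative _) (sym Te≡Tf)) eq))
    ... | no Te≢Tf =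
      let X , X∈L , Xe≢-Xf = noAntiparallel e f e≢f in
      choose X∈L λ eq → Xe≢-Xf (begin
        lookup X e              ≡⟨ sym (neg-involutive _) ⟩
        neg (neg (lookup X e))  ≡⟨ cong neg (reorientSign-injectiveʳ (does (lookup T f ≟ₛ minus)) (begin
          relative (neg (lookup X e)) (lookup T f) ≡⟨ relative-negˡ (lookup X e) (lookup T f) ⟩
          neg (relative (lookup X e) (lookup T f)) ≡⟨ sym (relative-negʳ _ (T-full f)) ⟩
          relative (lookup X e) (neg (lookup T f)) ≡⟨ cong (relative _)
                                                             (sym (≢⇒≡neg (T-full e) (T-full f) Te≢Tf)) ⟩
          relative (lookup X e) (lookup T e)       ≡⟨ eq ⟩
          relative (lookup X f) (lookup T f)       ∎)) ⟩
        neg (lookup X f)        ∎)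
      where open ≡-Reasoning

  Neighbour : SignVec m → SignVec m → Set
  Neighbour T T′ = ∃[ f ] (Disagree T T′ f × L (flipAt f T))

  module _ {T} (T∈L : L T) (T-full : FullSupport T) where

    NeighbourWithin : ℕ → Set
    NeighbourWithin n =
      ∀ {T′} → L T′ → FullSupport T′ → distance T T′ ≤ n → ∀ {e} → Disagree T T′ e → Neighbour T T′

    -- Eliminating e between T and T′ gives Z, equal to T wherever T′ is and zero at e. Unless T′
    -- is itself adjacent to T, composing Z with T′, with T, or with W ∘ T for a separator W
    -- yields a tope strictly between T and T′, to which the induction hypothesis applies.
    module Step {n} (ih : NeighbourWithin n) {T′} (T′∈L : L T′) (T′-full : FullSupport T′)
                (d≤1+n : distance T T′ ≤ suc n) {e} (De : Disagree T T′ e) where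

      viaCloser : ∀ {A} → L A → FullSupport A →
                  (∀ {x} → lookup T x ≡ lookup T′ x → lookup A x ≡ lookup T x) →
                  ∀ {w u} → Disagree T T′ w → lookup A w ≡ lookup T w → Disagree T A u → Neighbour T T′
      viaCloser {A} A∈L A-full agree {w} Dw Aw≡Tw DAu =
        let f , DAf , flip∈L = ih A∈L A-full (≤-pred (≤-trans T-A<T-T′ d≤1+n)) DAu in
        f , A⊆T′ DAf , flip∈L
        where
        A⊆T′ : ∀ {x} → Disagree T A x → Disagree T T′ x
        A⊆T′ DAx Tx≡T′x = DAx (sym (agree Tx≡T′x))
        T-A<T-T′ : distance T A < distance T T′
        T-A<T-T′ = count-< (λ x → ¬? (lookup T x ≟ₛ lookup A x)) (λ x → ¬? (lookup T x ≟ₛ lookup T′ x))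
                           A⊆T′ {w} Dw (λ DAw → DAw (sym Aw≡Tw))

      elimination : ∃[ Z ] (L Z × lookup Z e ≡ zer ×
                            (∀ f → ¬ Separates T T′ f → lookup Z f ≡ lookup (T ∘ᵥ T′) f))
      elimination = L3 T T′ T∈L T′∈L e (T-full e , ≢⇒≡neg (T-full e) (T′-full e) De)

      Z : SignVec m
      Z = proj₁ elimination

      Z∈L : L Z
      Z∈L = proj₁ (proj₂ elimination)

      Zₑ≡0 : lookup Z e ≡ zer
      Zₑ≡0 = proj₁ (proj₂ (proj₂ elimination))

      Z-agrees : ∀ {x} → lookup T x ≡ lookup T′ x → lookup Z x ≡ lookup T x
      Z-agrees {x} Tx≡T′x = begin
        lookup Z x                 ≡⟨ proj₂ (proj₂ (proj₂ elimination)) x ¬separates ⟩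
        lookup (T ∘ᵥ T′) x         ≡⟨ lookup-∘ᵥ T T′ x ⟩
        lookup T x ∘ₛ lookup T′ x  ≡⟨ ∘ₛ-nonzeroˡ _ (T-full x) ⟩
        lookup T x                 ∎
        where
        open ≡-Reasoning
        ¬separates : ¬ Separates T T′ x
        ¬separates (_ , Tx≡-T′x) = neg-≢ (T-full x) (sym (trans Tx≡-T′x (cong neg (sym Tx≡T′x))))

      viaComposite : ∀ {V} → L V → FullSupport V → ∀ {w u} → Disagree T T′ w →
                     lookup Z w ∘ₛ lookup V w ≡ lookup T w → lookup Z u ∘ₛ lookup V u ≢ lookup T u →
                     Neighbour T T′
      viaComposite {V} V∈L V-full {w} {u} Dw ZVw≡Tw ZVu≢Tu =
        viaCloser (L2 Z V Z∈L V∈L) ZV-full agree Dw (trans (lookup-∘ᵥ Z V w) ZVw≡Tw)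
                  (λ Tu≡ZVu → ZVu≢Tu (sym (trans Tu≡ZVu (lookup-∘ᵥ Z V u))))
        where
        ZV-full : FullSupport (Z ∘ᵥ V)
        ZV-full x = ∘ₛ-nonzeroʳ (lookup Z x) (V-full x) ∘ trans (sym (lookup-∘ᵥ Z V x))
        agree : ∀ {x} → lookup T x ≡ lookup T′ x → lookup (Z ∘ᵥ V) x ≡ lookup T x
        agree {x} Tx≡T′x = trans (lookup-∘ᵥ Z V x)
          (trans (cong (_∘ₛ lookup V x) (Z-agrees Tx≡T′x)) (∘ₛ-nonzeroˡ _ (T-full x)))

      module _ (Z-vanishes : ∀ {g} → Disagree T T′ g → lookup Z g ≡ zer) where

        viaSeparator : ∀ {W} → L W → ∀ {g₁ g₂} → Disagree T T′ g₁ → Disagree T T′ g₂ →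
                       Reverses W T g₁ → ¬ Reverses W T g₂ → Neighbour T T′
        viaSeparator {W} W∈L {g₁} {g₂} Dg₁ Dg₂ W₁ ¬W₂ =
          viaComposite (L2 W T W∈L T∈L) WT-full {w = g₂} {u = g₁} Dg₂
            (trans (cong (_∘ₛ _) (Z-vanishes Dg₂))
                   (trans (lookup-∘ᵥ W T g₂) (∘ₛ-nonreversing (T-full g₂) ¬W₂)))
            (λ eq → neg-≢ (T-full g₁) (begin
              neg (lookup T g₁)                  ≡⟨ sym (∘ₛ-nonzeroˡ _ (neg-nonzero (T-full g₁))) ⟩
              neg (lookup T g₁) ∘ₛ lookup T g₁   ≡⟨ cong (_∘ₛ lookup T g₁) (sym W₁) ⟩
              lookup W g₁ ∘ₛ lookup T g₁         ≡⟨ sym (lookup-∘ᵥ W T g₁) ⟩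
              lookup (W ∘ᵥ T) g₁                 ≡⟨ cong (_∘ₛ _) (sym (Z-vanishes Dg₁)) ⟩
              lookup Z g₁ ∘ₛ lookup (W ∘ᵥ T) g₁  ≡⟨ eq ⟩
              lookup T g₁                        ∎))
          where
          open ≡-Reasoning
          WT-full : FullSupport (W ∘ᵥ T)
          WT-full x = ∘ₛ-nonzeroʳ (lookup W x) (T-full x) ∘ trans (sym (lookup-∘ᵥ W T x))

        T′-adjacent : (∀ {f} → Disagree T T′ f → f ≡ e) → Neighbour T T′
        T′-adjacent only-e = e , De , subst L (signVec-ext T′≗flip) T′∈L
          where
          T′≗flip : ∀ x → lookup T′ x ≡ lookup (flipAt e T) x
          T′≗flip x with x ≟ᶠ e | lookup T x ≟ₛ lookup T′ x
          ... | yes refl | _        = trans (≢⇒≡neg (T′-full e) (T-full e) (De ∘ sym)) (sym (lookup-flipAt e T))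
          ... | no x≢e   | yes same = trans (sym same) (sym (lookup-flipAt-other T x≢e))
          ... | no x≢e   | no Dx    = ⊥-elim (x≢e (only-e Dx))

        vanishingCase : Neighbour T T′
        vanishingCase with any? (λ f → ¬? (lookup T f ≟ₛ lookup T′ f) ×-dec ¬? (f ≟ᶠ e))
        ... | no ¬other = T′-adjacent (λ {f} Df → decidable-stable (f ≟ᶠ e) (λ f≢e → ¬other (f , Df , f≢e)))
        ... | yes (f , Df , f≢e) with separator {T} T-full {e} {f} (f≢e ∘ sym)
        ...   | W , W∈L , inj₁ (We , ¬Wf) = viaSeparator W∈L De Df We ¬Wf
        ...   | W , W∈L , inj₂ (Wf , ¬We) = viaSeparator W∈L Df De Wf ¬We

      neighbourStep : Neighbour T T′
      neighbourStep with any? (λ g → ¬? (lookup T g ≟ₛ lookup T′ g) ×-dec (lookup Z g ≟ₛ lookup T g))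
      ... | yes (g , Dg , Zg≡Tg) =
        viaComposite T′∈L T′-full {u = e} Dg (trans (cong (_∘ₛ _) Zg≡Tg) (∘ₛ-nonzeroˡ _ (T-full g)))
                     (λ eq → De (sym (trans (cong (_∘ₛ lookup T′ e) (sym Zₑ≡0)) eq)))
      ... | no ¬Z≡T with any? (λ g → ¬? (lookup T g ≟ₛ lookup T′ g) ×-dec (lookup Z g ≟ₛ lookup T′ g))
      ...   | yes (g , Dg , Zg≡T′g) =
        viaComposite T∈L T-full {u = g} De (cong (_∘ₛ lookup T e) Zₑ≡0)
                     (λ eq → Dg (trans (sym eq) (trans (cong (_∘ₛ _) Zg≡T′g) (∘ₛ-nonzeroˡ _ (T′-full g)))))
      ...   | no ¬Z≡T′ = vanishingCase λ {g} Dg → ≢∧≢neg⇒zer (T-full g) (λ eq → ¬Z≡T (g , Dg , eq))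
                  (λ eq → ¬Z≡T′ (g , Dg , trans eq (sym (≢⇒≡neg (T′-full g) (T-full g) (Dg ∘ sym)))))

    neighbourWithin : ∀ n → NeighbourWithin n
    neighbourWithin zero    _    _       d≤0 {e} De = ⊥-elim (count≡0⇒¬ _ (n≤0⇒n≡0 d≤0) e De)
    neighbourWithin (suc n) T′∈L T′-full d≤  De     =
      Step.neighbourStep (neighbourWithin n) T′∈L T′-full d≤ De

    neighbour : ∀ {T′} → L T′ → FullSupport T′ → ∀ {e} → Disagree T T′ e → Neighbour T T′
    neighbour T′∈L T′-full = neighbourWithin m T′∈L T′-full (count-≤-size _)

-- Paths of topes from T to −T

module TopePath {m} (L : SignVec m → Set) (T : SignVec m) where

  reversedBy : ℕ → ℕ → Bool
  reversedBy zero    j = false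
  reversedBy (suc r) j = does (suc r ≤? j)

  reversedBy-stable : ∀ {r k j} → r ≤ k → k ≤ j → reversedBy r j ≡ reversedBy r k
  reversedBy-stable {zero}          _   _   = refl
  reversedBy-stable {suc r} {k} {j} r≤k k≤j =
    trans (dec-true (suc r ≤? j) (≤-trans r≤k k≤j)) (sym (dec-true (suc r ≤? k) r≤k))

  stage : (Fin m → ℕ) → ℕ → SignVec m
  stage rank j = tabulate λ e → reorientSign (reversedBy (rank e) j) (lookup T e)

  lookup-stage : ∀ rank j e → lookup (stage rank j) e ≡ reorientSign (reversedBy (rank e) j) (lookup T e)
  lookup-stage rank j = lookup∘tabulate _

  stage-full : FullSupport T → ∀ rank j → FullSupport (stage rank j)
  stage-full T-full rank j e =
    reorientSign-nonzero (reversedBy (rank e) j) (T-full e) ∘ trans (sym (lookup-stage rank j e))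

  lookup-stage-unranked : ∀ rank {j e} → rank e ≡ 0 → lookup (stage rank j) e ≡ lookup T e
  lookup-stage-unranked rank {j} {e} rank≡0 =
    trans (lookup-stage rank j e) (cong (λ r → reorientSign (reversedBy r j) (lookup T e)) rank≡0)

  lookup-stage-reversed : ∀ rank {j e} → 1 ≤ rank e → rank e ≤ j → lookup (stage rank j) e ≡ neg (lookup T e)
  lookup-stage-reversed rank {j} {e} 1≤r r≤j with rank e | lookup-stage rank j e
  ... | suc r | stage≡ = trans stage≡ (cong (λ b → reorientSign b (lookup T e)) (dec-true (suc r ≤? j) r≤j))

  -- The first k steps of a path from T: the element of rank j ≥ 1 is reversed at step j (rank 0:
  -- not yet), so stage rank j is the tope reached after j steps; element j is the element of
  -- rank j, meaningful only for 1 ≤ j ≤ k. The last field is the reindexing of counts by rank.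
  record Path (k : ℕ) : Set₁ where
    field
      rank            : Fin m → ℕ
      element         : ℕ → Fin m
      rank-≤          : ∀ e → rank e ≤ k
      rank-element    : ∀ {j} → 1 ≤ j → j ≤ k → rank (element j) ≡ j
      element-rank    : ∀ {e} → 1 ≤ rank e → element (rank e) ≡ e
      stage∈L         : ∀ j → L (stage rank j)
      ranked+unranked : ∀ {P : Fin m → Set} (P? : Decidable P) →
        countRange (λ j → does (P? (element j))) 1 k + count (λ e → (rank e ≟ 0) ×-dec P? e) ≡ count P?

  module _ {k} (path : Path k) where

    open Path path

    unranked-count : k + count (λ e → rank e ≟ 0) ≡ m
    unranked-count = begin
      k + count (λ e → rank e ≟ 0)
        ≡⟨ cong₂ _+_ (sym (countRange-true 1 k))
                     (count-cong (λ e → rank e ≟ 0) Unranked? (λ _ → sym (∧-identityʳ _))) ⟩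
      countRange (λ _ → true) 1 k + count Unranked?
        ≡⟨ ranked+unranked everything? ⟩
      count everything?
        ≡⟨ count-all everything? (λ _ → tt) ⟩
      m ∎
      where
      open ≡-Reasoning
      everything? : Decidable {A = Fin m} (λ _ → ⊤)
      everything? _ = yes tt
      Unranked? : Decidable (λ e → rank e ≡ 0 × ⊤)
      Unranked? e = (rank e ≟ 0) ×-dec everything? e

    unranked-exists : k < m → ∃[ e ] (rank e ≡ 0)
    unranked-exists k<m = count>0⇒∃ (λ e → rank e ≟ 0) (n≢0⇒n>0 λ c≡0 →
      <⇒≢ k<m (trans (sym (+-identityʳ k)) (trans (cong (k +_) (sym c≡0)) unranked-count)))

    unranked⇒disagree : FullSupport T → ∀ {e} → rank e ≡ 0 → Disagree (stage rank k) (negVec T) e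
    unranked⇒disagree T-full {e} rank≡0 eq =
      neg-≢ (T-full e) (sym (trans (sym (lookup-stage-unranked rank rank≡0)) (trans eq (lookup-negVec T e))))

    disagree⇒unranked : ∀ {e} → Disagree (stage rank k) (negVec T) e → rank e ≡ 0
    disagree⇒unranked {e} De with rank e in rank≡
    ... | zero  = refl
    ... | suc r = ⊥-elim (De (trans (lookup-stage-reversed rank (subst (1 ≤_) (sym rank≡) z<s) (rank-≤ e))
                                    (sym (lookup-negVec T e))))

module Geodesic {m} {L : SignVec m → Set} (om : IsOM m L)
                (noParallel : NoParallel L) (noAntiparallel : NoAntiparallel L)
                {T : SignVec m} (T∈L : L T) (T-full : FullSupport T) where

  open IsOM om
  open Adjacency om noParallel noAntiparallel
  open TopePath L T

  emptyPath : Fin m → Path 0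
  emptyPath e₀ = record
    { rank            = λ _ → 0
    ; element         = λ _ → e₀
    ; rank-≤          = λ _ → z≤n
    ; rank-element    = λ 1≤j j≤0 → ⊥-elim (<⇒≱ 1≤j j≤0)
    ; element-rank    = λ ()
    ; stage∈L         = λ j → subst L (sym (tabulate∘lookup T)) T∈L
    ; ranked+unranked = λ P? → count-cong _ P? (λ _ → refl)
    }

  nextElement : ∀ {k} (path : Path k) → k < m →
                ∃[ f ] (Path.rank path f ≡ 0 × L (flipAt f (stage (Path.rank path) k)))
  nextElement {k} path k<m =
    let e , rank≡0      = unranked-exists path k<m
        f , Df , flip∈L = neighbour (stage∈L k) (stage-full T-full rank k)
                                    (L1 T T∈L) (negVec-fullSupport T T-full) (unranked⇒disagree path T-full rank≡0)
    in f , disagree⇒unranked path Df , flip∈L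
    where open Path path

  module Extend {k} (path : Path k) (f : Fin m) (f-unranked : Path.rank path f ≡ 0)
                (flip∈L : L (flipAt f (stage (Path.rank path) k))) where

    open Path path

    rank′ : Fin m → ℕ
    rank′ = updateAt rank f (λ _ → suc k)

    rank′-f : rank′ f ≡ suc k
    rank′-f = updateAt-updates f rank

    rank′-other : ∀ {x} → x ≢ f → rank′ x ≡ rank x
    rank′-other {x} x≢f = updateAt-minimal x f rank x≢f

    element′ : ℕ → Fin m
    element′ j with j ≟ suc k
    ... | yes _ = f
    ... | no  _ = element j

    element′-new : element′ (suc k) ≡ f
    element′-new with suc k ≟ suc k
    ... | yes _   = refl
    ... | no  k≢k = ⊥-elim (k≢k refl)

    element′-old : ∀ {j} → j ≢ suc k → element′ j ≡ element j
    element′-old {j} j≢1+k with j ≟ suc k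
    ... | yes j≡1+k = ⊥-elim (j≢1+k j≡1+k)
    ... | no  _     = refl

    f≢element : ∀ {j} → 1 ≤ j → j ≤ k → element j ≢ f
    f≢element {j} 1≤j j≤k eq =
      <⇒≢ 1≤j (sym (trans (sym (rank-element 1≤j j≤k)) (trans (cong rank eq) f-unranked)))

    rank′-≤ : ∀ x → rank′ x ≤ suc k
    rank′-≤ x with x ≟ᶠ f
    ... | yes refl = ≤-reflexive rank′-f
    ... | no  x≢f  = subst (_≤ suc k) (sym (rank′-other x≢f)) (m≤n⇒m≤1+n (rank-≤ x))

    rank′-element′ : ∀ {j} → 1 ≤ j → j ≤ suc k → rank′ (element′ j) ≡ j
    rank′-element′ {j} 1≤j j≤1+k with m≤n⇒m<n∨m≡n j≤1+k
    ... | inj₂ refl  = trans (cong rank′ element′-new) rank′-f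
    ... | inj₁ j<1+k = begin
      rank′ (element′ j) ≡⟨ cong rank′ (element′-old (<⇒≢ j<1+k)) ⟩
      rank′ (element j)  ≡⟨ rank′-other (f≢element 1≤j (≤-pred j<1+k)) ⟩
      rank (element j)   ≡⟨ rank-element 1≤j (≤-pred j<1+k) ⟩
      j                  ∎
      where open ≡-Reasoning

    element′-rank′ : ∀ {x} → 1 ≤ rank′ x → element′ (rank′ x) ≡ x
    element′-rank′ {x} 1≤r with x ≟ᶠ f
    ... | yes refl = trans (cong element′ rank′-f) element′-new
    ... | no  x≢f  = begin
      element′ (rank′ x) ≡⟨ cong element′ (rank′-other x≢f) ⟩
      element′ (rank x)  ≡⟨ element′-old (λ r≡1+k → 1+n≰n (subst (_≤ k) r≡1+k (rank-≤ x))) ⟩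
      element (rank x)   ≡⟨ element-rank (subst (1 ≤_) (rank′-other x≢f) 1≤r) ⟩
      x                  ∎
      where open ≡-Reasoning

    stage′-early : ∀ {j} → j ≤ k → stage rank′ j ≡ stage rank j
    stage′-early {j} j≤k = tabulate-cong λ x → cong (λ b → reorientSign b (lookup T x)) (same x)
      where
      same : ∀ x → reversedBy (rank′ x) j ≡ reversedBy (rank x) j
      same x with x ≟ᶠ f
      ... | no  x≢f  = cong (λ r → reversedBy r j) (rank′-other x≢f)
      ... | yes refl = begin
        reversedBy (rank′ f) j  ≡⟨ cong (λ r → reversedBy r j) rank′-f ⟩
        does (suc k ≤? j)       ≡⟨ dec-false (suc k ≤? j) (λ 1+k≤j → 1+n≰n (≤-trans 1+k≤j j≤k)) ⟩
        false                   ≡⟨ cong (λ r → reversedBy r j) (sym f-unranked) ⟩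
        reversedBy (rank f) j   ∎
        where open ≡-Reasoning

    stage′-late : ∀ {j} → k < j → stage rank′ j ≡ flipAt f (stage rank k)
    stage′-late {j} k<j = signVec-ext same
      where
      same : ∀ x → lookup (stage rank′ j) x ≡ lookup (flipAt f (stage rank k)) x
      same x with x ≟ᶠ f
      ... | yes refl = begin
        lookup (stage rank′ j) f             ≡⟨ lookup-stage-reversed rank′ (subst (1 ≤_) (sym rank′-f) z<s)
                                                                         (subst (_≤ j) (sym rank′-f) k<j) ⟩
        neg (lookup T f)                     ≡⟨ cong neg (sym (lookup-stage-unranked rank f-unranked)) ⟩
        neg (lookup (stage rank k) f)        ≡⟨ sym (lookup-flipAt f (stage rank k)) ⟩
        lookup (flipAt f (stage rank k)) f   ∎
        where open ≡-Reasoning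
      ... | no x≢f = begin
        lookup (stage rank′ j) x
          ≡⟨ lookup-stage rank′ j x ⟩
        reorientSign (reversedBy (rank′ x) j) (lookup T x)
          ≡⟨ cong (λ r → reorientSign (reversedBy r j) (lookup T x)) (rank′-other x≢f) ⟩
        reorientSign (reversedBy (rank x) j) (lookup T x)
          ≡⟨ cong (λ b → reorientSign b (lookup T x)) (reversedBy-stable (rank-≤ x) (<⇒≤ k<j)) ⟩
        reorientSign (reversedBy (rank x) k) (lookup T x)
          ≡⟨ sym (lookup-stage rank k x) ⟩
        lookup (stage rank k) x
          ≡⟨ sym (lookup-flipAt-other (stage rank k) x≢f) ⟩
        lookup (flipAt f (stage rank k)) x ∎
        where open ≡-Reasoning

    stage′∈L : ∀ j → L (stage rank′ j)
    stage′∈L j with j ≤? k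
    ... | yes j≤k = subst L (sym (stage′-early j≤k)) (stage∈L j)
    ... | no  j≰k = subst L (sym (stage′-late (≰⇒> j≰k))) flip∈L

    ranked+unranked′ : ∀ {P : Fin m → Set} (P? : Decidable P) →
      countRange (λ j → does (P? (element′ j))) 1 (suc k) + count (λ e → (rank′ e ≟ 0) ×-dec P? e) ≡ count P?
    ranked+unranked′ {P} P? = begin
      countRange (λ j → does (P? (element′ j))) 1 (suc k) + count U′?  ≡⟨ cong (_+ count U′?) ranked′ ⟩
      (ranked + ⟦ does (P? f) ⟧) + count U′?                          ≡⟨ +-assoc ranked _ _ ⟩
      ranked + (⟦ does (P? f) ⟧ + count U′?)                          ≡⟨ cong (ranked +_) (sym unranked′) ⟩
      ranked + count U?                                               ≡⟨ ranked+unranked P? ⟩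
      count P?                                                        ∎
      where
      open ≡-Reasoning
      ranked : ℕ
      ranked = countRange (λ j → does (P? (element j))) 1 k
      U? : Decidable (λ e → rank e ≡ 0 × P e)
      U? e = (rank e ≟ 0) ×-dec P? e
      U′? : Decidable (λ e → rank′ e ≡ 0 × P e)
      U′? e = (rank′ e ≟ 0) ×-dec P? e
      ranked′ : countRange (λ j → does (P? (element′ j))) 1 (suc k) ≡ ranked + ⟦ does (P? f) ⟧
      ranked′ = trans (countRange-snoc _ 1 k)
        (cong₂ _+_ (countRange-cong 1 k (λ j∈ → cong (does ∘ P?) (element′-old (<⇒≢ (proj₂ j∈)))))
                   (cong (λ e → ⟦ does (P? e) ⟧) element′-new))
      unranked′ : count U? ≡ ⟦ does (P? f) ⟧ + count U′?
      unranked′ = trans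
        (count-remove U? U′? f (λ e e≢f → cong (λ r → does ((r ≟ 0) ×-dec P? e)) (sym (rank′-other e≢f)))
                               (λ (r≡0 , _) → 1+n≢0 (trans (sym rank′-f) r≡0)))
        (cong (λ b → ⟦ b ∧ does (P? f) ⟧ + count U′?) (dec-true (rank f ≟ 0) f-unranked))

  extend : ∀ {k} → Path k → k < m → Path (suc k)
  extend path k<m with nextElement path k<m
  ... | f , f-unranked , flip∈L = record
    { rank            = rank′
    ; element         = element′
    ; rank-≤          = rank′-≤
    ; rank-element    = rank′-element′
    ; element-rank    = element′-rank′
    ; stage∈L         = stage′∈L
    ; ranked+unranked = ranked+unranked′
    }
    where open Extend path f f-unranked flip∈L

  pathOfLength : Fin m → ∀ k → k ≤ m → Path k
  pathOfLength e₀ zero    _     = emptyPath e₀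
  pathOfLength e₀ (suc k) 1+k≤m = extend (pathOfLength e₀ k (<⇒≤ 1+k≤m)) 1+k≤m

-- The committee of peak topes

record OddBoundedCommittee {m} (L : SignVec m → Set) (s : ℕ) : Set where
  field
    members     : List (SignVec m)
    isCommittee : IsTopeCommittee L members
    odd         : ∃[ x ] (length members ≡ 1 + 2 * x)
    ≤m          : length members ≤ m
    ≤1+2s       : length members ≤ 1 + 2 * s

module TopeCycle {n} {L : SignVec (suc n) → Set} (negVec∈L : ∀ X → L X → L (negVec X))
                 {T : SignVec (suc n)} (T-full : FullSupport T) (path : TopePath.Path L T (suc n)) where

  m : ℕ
  m = suc n

  open TopePath L T
  open Path path
  open Window m

  IsMinus? : Decidable (λ e → lookup T e ≡ minus)
  IsMinus? e = lookup T e ≟ₛ minus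

  rank-positive : ∀ e → 1 ≤ rank e
  rank-positive e = n≢0⇒n>0 λ rank≡0 → count≡0⇒¬ (λ e → rank e ≟ 0) none e rank≡0
    where
    none : count (λ e → rank e ≟ 0) ≡ 0
    none = +-cancelˡ-≡ m _ 0 (trans (unranked-count path) (sym (+-identityʳ m)))

  -- For 0 ≤ j < 2m: the stages T, …, −T of the path, followed by the negatives of the inner ones.
  cycle : ℕ → SignVec m
  cycle j with j ≤? m
  ... | yes _ = stage rank j
  ... | no  _ = negVec (stage rank (j ∸ m))

  cycle∈L : ∀ j → L (cycle j)
  cycle∈L j with j ≤? m
  ... | yes _ = stage∈L j
  ... | no  _ = negVec∈L _ (stage∈L (j ∸ m))

  reversedBy-early : ∀ {r j} → 1 ≤ r → j ≤ m → reversedBy r j ≡ inWindow r j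
  reversedBy-early {suc r} {j} _ j≤m =
    sym (trans (cong (does (suc r ≤? j) ∧_) (dec-true (j <? suc r + m) (s≤s (≤-trans j≤m (m≤n+m m r)))))
               (∧-identityʳ _))

  reversedBy-late : ∀ {r j} → 1 ≤ r → r ≤ m → m < j → not (reversedBy r (j ∸ m)) ≡ inWindow r j
  reversedBy-late {suc r} {j} _ r≤m m<j with suc r ≤? j ∸ m
  ... | yes r≤j∸m = trans (cong not (dec-true (suc r ≤? j ∸ m) r≤j∸m))
    (sym (inWindow-after {p = suc r} (subst (suc r + m ≤_) (m∸n+n≡m (<⇒≤ m<j)) (+-monoˡ-≤ m r≤j∸m))))
  ... | no  r≰j∸m = trans (cong not (dec-false (suc r ≤? j ∸ m) r≰j∸m))
    (sym (inWindow-inside (≤-trans r≤m (<⇒≤ m<j))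
                          (subst (_< suc r + m) (m∸n+n≡m (<⇒≤ m<j)) (+-monoˡ-< m (≰⇒> r≰j∸m)))))

  lookup-cycle : ∀ j e → lookup (cycle j) e ≡ reorientSign (inWindow (rank e) j) (lookup T e)
  lookup-cycle j e with j ≤? m
  ... | yes j≤m = trans (lookup-stage rank j e)
                        (cong (λ b → reorientSign b (lookup T e)) (reversedBy-early (rank-positive e) j≤m))
  ... | no  j≰m = begin
    lookup (negVec (stage rank (j ∸ m))) e
      ≡⟨ lookup-negVec (stage rank (j ∸ m)) e ⟩
    neg (lookup (stage rank (j ∸ m)) e)
      ≡⟨ cong neg (lookup-stage rank (j ∸ m) e) ⟩
    neg (reorientSign (reversedBy (rank e) (j ∸ m)) (lookup T e))
      ≡⟨ neg-reorientSign (reversedBy (rank e) (j ∸ m)) _ ⟩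
    reorientSign (not (reversedBy (rank e) (j ∸ m))) (lookup T e)
      ≡⟨ cong (λ b → reorientSign b (lookup T e)) (reversedBy-late (rank-positive e) (rank-≤ e) (≰⇒> j≰m)) ⟩
    reorientSign (inWindow (rank e) j) (lookup T e) ∎
    where open ≡-Reasoning

  cycle-full : ∀ j → FullSupport (cycle j)
  cycle-full j e = reorientSign-nonzero (inWindow (rank e) j) (T-full e) ∘ trans (sym (lookup-cycle j e))

  cycle-injective : ∀ {i j} → i < j → j < m + m → cycle i ≢ cycle j
  cycle-injective {i} {j} i<j j<2m cycleᵢ≡cycleⱼ with separatingRank z<s i<j j<2m
  ... | p , 1≤p , p≤m , differ = differ (subst (λ r → inWindow r i ≡ inWindow r j) (rank-element 1≤p p≤m)
          (reorientSign-injectiveˡ (T-full e) (begin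
            reorientSign (inWindow (rank e) i) (lookup T e)  ≡⟨ sym (lookup-cycle i e) ⟩
            lookup (cycle i) e                               ≡⟨ cong (λ X → lookup X e) cycleᵢ≡cycleⱼ ⟩
            lookup (cycle j) e                               ≡⟨ lookup-cycle j e ⟩
            reorientSign (inWindow (rank e) j) (lookup T e)  ∎)))
    where
    open ≡-Reasoning
    e : Fin m
    e = element p

  minusAt : ℕ → Bool
  minusAt j = does (IsMinus? (element j))

  minusAt-count : countRange minusAt 1 m ≡ count IsMinus?
  minusAt-count = begin
    countRange minusAt 1 m                    ≡⟨ sym (+-identityʳ _) ⟩
    countRange minusAt 1 m + 0                ≡⟨ cong (countRange minusAt 1 m +_) (sym (count-none Unranked? unranked)) ⟩
    countRange minusAt 1 m + count Unranked?  ≡⟨ ranked+unranked IsMinus? ⟩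
    count IsMinus?                            ∎
    where
    open ≡-Reasoning
    Unranked? : Decidable (λ e → rank e ≡ 0 × lookup T e ≡ minus)
    Unranked? e = (rank e ≟ 0) ×-dec IsMinus? e
    unranked : ∀ e → ¬ (rank e ≡ 0 × lookup T e ≡ minus)
    unranked e (rank≡0 , _) = <⇒≢ (rank-positive e) (sym rank≡0)

  -- rise j: the step from cycle (j − 1) to cycle j, indices taken mod 2m, makes an element positive.
  rise : ℕ → Bool
  rise zero    = not (minusAt m)
  rise (suc j) = if does (suc j ≤? m) then minusAt (suc j) else not (minusAt (suc j ∸ m))

  rise-early : ∀ {j} → 1 ≤ j → j ≤ m → rise j ≡ minusAt j
  rise-early {suc j} _ j≤m =
    cong (λ b → if b then minusAt (suc j) else not (minusAt (suc j ∸ m))) (dec-true (suc j ≤? m) j≤m)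

  rise-late : ∀ {j} → m < suc j → rise (suc j) ≡ not (minusAt (suc j ∸ m))
  rise-late {j} m<j =
    cong (λ b → if b then minusAt (suc j) else not (minusAt (suc j ∸ m))) (dec-false (suc j ≤? m) (<⇒≱ m<j))

  rise-antiperiodic : ∀ {j} → j ≤ m → rise (j + m) ≡ not (rise j)
  rise-antiperiodic {zero}  _   = trans (rise-early z<s ≤-refl) (sym (not-involutive _))
  rise-antiperiodic {suc j} j≤m = begin
    rise (suc j + m)               ≡⟨ rise-late (s≤s (m≤n+m m j)) ⟩
    not (minusAt (suc j + m ∸ m))  ≡⟨ cong (not ∘ minusAt) (m+n∸n≡m (suc j) m) ⟩
    not (minusAt (suc j))          ≡⟨ cong not (sym (rise-early z<s j≤m)) ⟩
    not (rise (suc j))             ∎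
    where open ≡-Reasoning

  rise-rank : ∀ e → rise (rank e) ≡ does (IsMinus? e)
  rise-rank e =
    trans (rise-early (rank-positive e) (rank-≤ e)) (cong (does ∘ IsMinus?) (element-rank (rank-positive e)))

  rise-count : countRange rise 1 m ≡ count IsMinus?
  rise-count = trans (countRange-cong 1 m (λ (1≤j , j<1+m) → rise-early 1≤j (≤-pred j<1+m))) minusAt-count

  open Peaks rise
  open Antiperiodic m rise-antiperiodic

  committee : List (SignVec m)
  committee = selectRange peak cycle 0 (m + m)

  committee-length : length committee ≡ countRange peak 0 (m + m)
  committee-length = length-selectRange peak cycle 0 (m + m)

  -- On the cycle, an element of rank p is positive exactly on the window [p, p + m) if it is
  -- negative in T, and exactly off it otherwise; peaks-window puts one more peak on that side.
  module Majority (e : Fin m) where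

    p In Out : ℕ
    p   = rank e
    In  = countRange peak p m
    Out = outsideWindow peak p

    isPlusAt : ℕ → Bool
    isPlusAt j = does (lookup (cycle j) e ≟ₛ plus)

    isPlusAt-reorient : ∀ {s} → lookup T e ≡ s → ∀ j →
                        isPlusAt j ≡ does (reorientSign (inWindow p j) s ≟ₛ plus)
    isPlusAt-reorient Te≡s j =
      cong (λ s → does (s ≟ₛ plus)) (trans (lookup-cycle j e) (cong (reorientSign (inWindow p j)) Te≡s))

    plusCount : countPlus e committee ≡ countRange (λ j → peak j ∧ isPlusAt j) 0 (m + m)
    plusCount = length-filter-selectRange peak cycle (λ X → lookup X e ≟ₛ plus) 0 (m + m)

    total : length committee ≡ In + Out
    total = trans committee-length (countRange-window peak (rank-≤ e))

    balance : ∀ {s} → lookup T e ≡ s → In + ⟦ not (does (s ≟ₛ minus)) ⟧ ≡ Out + ⟦ does (s ≟ₛ minus) ⟧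
    balance Te≡s = subst (λ b → In + ⟦ not b ⟧ ≡ Out + ⟦ b ⟧)
                         (trans (rise-rank e) (cong (λ s → does (s ≟ₛ minus)) Te≡s)) (peaks-window (rank-≤ e))

    won : ∀ {w l} → length committee ≡ l + w → countPlus e committee ≡ w → l + 1 ≡ w →
          length committee < 2 * countPlus e committee
    won total≡ plus≡ l+1≡w = subst₂ (λ a b → a < 2 * b) (sym total≡) (sym plus≡) (m+1≡n⇒m+n<2*n l+1≡w)

    byOrientation : ∀ s → lookup T e ≡ s → s ≢ zer → length committee < 2 * countPlus e committee
    byOrientation zer   _     s≢0 = ⊥-elim (s≢0 refl)
    byOrientation minus Te≡- _   =
      won (trans total (+-comm In Out))
          (trans plusCount (trans (countRange-cong 0 (m + m) λ {j} _ →
                                     cong (peak j ∧_) (trans (isPlusAt-reorient Te≡- j) (isPlus-reorient-minus _)))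
                                  (countRange-inWindow peak (rank-≤ e))))
          (sym (trans (sym (+-identityʳ In)) (balance Te≡-)))
    byOrientation plus  Te≡+ _   =
      won total
          (trans plusCount (trans (countRange-cong 0 (m + m) λ {j} _ →
                                     cong (peak j ∧_) (trans (isPlusAt-reorient Te≡+ j) (isPlus-reorient-plus _)))
                                  (countRange-outsideWindow peak (rank-≤ e))))
          (trans (balance Te≡+) (+-identityʳ Out))

  committee-majority : ∀ e → length committee < 2 * countPlus e committee
  committee-majority e = Majority.byOrientation e (lookup T e) refl (T-full e)

  committee-isTopeCommittee : IsTopeCommittee L committee
  committee-isTopeCommittee =
    selectRange-unique peak cycle 0 (m + m) (λ i<j _ (_ , j<2m) → cycle-injective i<j j<2m) ,
    selectRange-all peak cycle 0 (m + m) (λ {j} _ → fullSupport⇒tope (cycle∈L j) (cycle-full j)) ,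
    committee-majority

  committee-≤ : length committee ≤ m
  committee-≤ = subst (_≤ m) (sym committee-length) peaks-≤

  committee-odd : ∃[ x ] (length committee ≡ 1 + 2 * x)
  committee-odd = let x , total≡ , _ = peaks-odd in x , trans committee-length total≡

  committee-≤-minus : length committee ≤ 1 + 2 * count IsMinus?
  committee-≤-minus = subst₂ _≤_ (sym committee-length) (cong (λ c → 1 + 2 * c) rise-count) peaks-≤-rises

  peakCommittee : OddBoundedCommittee L (count IsMinus?)
  peakCommittee = record
    { members     = committee
    ; isCommittee = committee-isTopeCommittee
    ; odd         = committee-odd
    ; ≤m          = committee-≤
    ; ≤1+2s       = committee-≤-minus
    }

oddBoundedCommittee : ∀ {n} {L : SignVec (suc n) → Set} → IsOM (suc n) L → NoParallel L → NoAntiparallel L →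
                      ∀ {T} → L T → FullSupport T → OddBoundedCommittee L (count (λ e → lookup T e ≟ₛ minus))
oddBoundedCommittee {n} om noParallel noAntiparallel T∈L T-full =
  TopeCycle.peakCommittee (IsOM.L1 om) T-full
    (Geodesic.pathOfLength om noParallel noAntiparallel T∈L T-full zero (suc n) ≤-refl)

parityBounded : ∀ {m} {L : SignVec m → Set} {s} → OddBoundedCommittee L s → HasParityBoundedCommittee L
parityBounded C = members , isCommittee , (λ _ → ≤m) , odd≤even⇒≤pred (proj₁ odd) (proj₂ odd) ≤m
  where open OddBoundedCommittee C

-- Reorientation

module Reorientation {m} (A : Fin m → Bool) where

  reorient-negVec : ∀ X → reorient A (negVec X) ≡ negVec (reorient A X)
  reorient-negVec X = signVec-ext λ e → begin
    lookup (reorient A (negVec X)) e          ≡⟨ lookup-reorient A (negVec X) e ⟩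
    reorientSign (A e) (lookup (negVec X) e)  ≡⟨ cong (reorientSign (A e)) (lookup-negVec X e) ⟩
    reorientSign (A e) (neg (lookup X e))     ≡⟨ reorientSign-neg (A e) _ ⟩
    neg (reorientSign (A e) (lookup X e))     ≡⟨ cong neg (sym (lookup-reorient A X e)) ⟩
    neg (lookup (reorient A X) e)             ≡⟨ sym (lookup-negVec (reorient A X) e) ⟩
    lookup (negVec (reorient A X)) e          ∎
    where open ≡-Reasoning

  reorient-∘ᵥ : ∀ X Y → reorient A (X ∘ᵥ Y) ≡ reorient A X ∘ᵥ reorient A Y
  reorient-∘ᵥ X Y = signVec-ext λ e → begin
    lookup (reorient A (X ∘ᵥ Y)) e
      ≡⟨ lookup-reorient A (X ∘ᵥ Y) e ⟩
    reorientSign (A e) (lookup (X ∘ᵥ Y) e)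
      ≡⟨ cong (reorientSign (A e)) (lookup-∘ᵥ X Y e) ⟩
    reorientSign (A e) (lookup X e ∘ₛ lookup Y e)
      ≡⟨ reorientSign-∘ₛ (A e) _ _ ⟩
    reorientSign (A e) (lookup X e) ∘ₛ reorientSign (A e) (lookup Y e)
      ≡⟨ sym (cong₂ _∘ₛ_ (lookup-reorient A X e) (lookup-reorient A Y e)) ⟩
    lookup (reorient A X) e ∘ₛ lookup (reorient A Y) e
      ≡⟨ sym (lookup-∘ᵥ (reorient A X) (reorient A Y) e) ⟩
    lookup (reorient A X ∘ᵥ reorient A Y) e ∎
    where open ≡-Reasoning

  reorient-zeroVec : reorient A zeroVec ≡ zeroVec
  reorient-zeroVec = signVec-ext λ e → begin
    lookup (reorient A zeroVec) e          ≡⟨ lookup-reorient A zeroVec e ⟩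
    reorientSign (A e) (lookup zeroVec e)  ≡⟨ cong (reorientSign (A e)) (lookup-replicate e zer) ⟩
    reorientSign (A e) zer                 ≡⟨ reorientSign-zer (A e) ⟩
    zer                                    ≡⟨ sym (lookup-replicate e zer) ⟩
    lookup zeroVec e                       ∎
    where open ≡-Reasoning

  separates-reorient : ∀ {X Y e} → Separates X Y e → Separates (reorient A X) (reorient A Y) e
  separates-reorient {X} {Y} {e} sep =
    subst₂ (λ a b → a ≢ zer × a ≡ neg b) (sym (lookup-reorient A X e)) (sym (lookup-reorient A Y e))
           (reorientSign-separates (A e) sep)

  separates-unreorient : ∀ {X Y e} → Separates (reorient A X) (reorient A Y) e → Separates X Y e
  separates-unreorient {X} {Y} {e} sep =
    subst₂ (λ a b → a ≢ zer × a ≡ neg b) (reorientSign-involutive (A e) _) (reorientSign-involutive (A e) _)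
           (reorientSign-separates (A e)
             (subst₂ (λ a b → a ≢ zer × a ≡ neg b) (lookup-reorient A X e) (lookup-reorient A Y e) sep))

  module _ {L : SignVec m → Set} where

    reorient-isOM : IsOM m L → IsOM m (reorientCov A L)
    reorient-isOM om = record
      { L0 = zeroVec , L0 , sym reorient-zeroVec
      ; L1 = λ { _ (X , X∈L , refl) → negVec X , L1 X X∈L , sym (reorient-negVec X) }
      ; L2 = λ { _ _ (X , X∈L , refl) (Y , Y∈L , refl) → X ∘ᵥ Y , L2 X Y X∈L Y∈L , sym (reorient-∘ᵥ X Y) }
      ; L3 = λ { _ _ (X , X∈L , refl) (Y , Y∈L , refl) e sep → eliminate X∈L Y∈L e sep }
      }
      where
      open IsOM om
      eliminate : ∀ {X Y} → L X → L Y → ∀ e → Separates (reorient A X) (reorient A Y) e →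
        ∃[ Z ] (reorientCov A L Z × lookup Z e ≡ zer ×
                (∀ f → ¬ Separates (reorient A X) (reorient A Y) f →
                       lookup Z f ≡ lookup (reorient A X ∘ᵥ reorient A Y) f))
      eliminate {X} {Y} X∈L Y∈L e sep =
        let Z , Z∈L , Ze≡0 , Z-rest = L3 X Y X∈L Y∈L e (separates-unreorient {X} {Y} sep) in
        reorient A Z , (Z , Z∈L , refl) ,
        trans (lookup-reorient A Z e) (trans (cong (reorientSign (A e)) Ze≡0) (reorientSign-zer (A e))) ,
        λ f ¬sep → begin
          lookup (reorient A Z) f                  ≡⟨ lookup-reorient A Z f ⟩
          reorientSign (A f) (lookup Z f)          ≡⟨ cong (reorientSign (A f))
                                                           (Z-rest f (¬sep ∘ separates-reorient {X} {Y})) ⟩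
          reorientSign (A f) (lookup (X ∘ᵥ Y) f)   ≡⟨ sym (lookup-reorient A (X ∘ᵥ Y) f) ⟩
          lookup (reorient A (X ∘ᵥ Y)) f           ≡⟨ cong (λ V → lookup V f) (reorient-∘ᵥ X Y) ⟩
          lookup (reorient A X ∘ᵥ reorient A Y) f  ∎
        where open ≡-Reasoning

    reorient-noParallelPair : NoParallel L → NoAntiparallel L → ∀ r → NoParallelPair r (reorientCov A L)
    reorient-noParallelPair noParallel noAntiparallel r e f e≢f =
      let X , X∈L , Xe≢ = noParallelPair (A e xor (r xor A f)) e f e≢f in
      reorient A X , (X , X∈L , refl) , λ eq → Xe≢ (begin
        lookup X e
          ≡⟨ sym (reorientSign-involutive (A e) _) ⟩
        reorientSign (A e) (reorientSign (A e) (lookup X e))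
          ≡⟨ cong (reorientSign (A e)) (sym (lookup-reorient A X e)) ⟩
        reorientSign (A e) (lookup (reorient A X) e)
          ≡⟨ cong (reorientSign (A e)) eq ⟩
        reorientSign (A e) (reorientSign r (lookup (reorient A X) f))
          ≡⟨ cong (λ a → reorientSign (A e) (reorientSign r a)) (lookup-reorient A X f) ⟩
        reorientSign (A e) (reorientSign r (reorientSign (A f) (lookup X f)))
          ≡⟨ trans (cong (reorientSign (A e)) (reorientSign-xor r (A f) _)) (reorientSign-xor (A e) _ _) ⟩
        reorientSign (A e xor (r xor A f)) (lookup X f) ∎)
      where
      open ≡-Reasoning
      noParallelPair : ∀ r → NoParallelPair r L
      noParallelPair false = noParallel
      noParallelPair true  = noAntiparallel

  lookup-reorient-plusVec : ∀ e → lookup (reorient A plusVec) e ≡ reorientSign (A e) plus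
  lookup-reorient-plusVec e = trans (lookup-reorient A plusVec e) (cong (reorientSign (A e)) (lookup-replicate e plus))

  reorient-plusVec-full : FullSupport (reorient A plusVec)
  reorient-plusVec-full e = reorientSign-nonzero (A e) (λ ()) ∘ trans (sym (lookup-reorient-plusVec e))

  reorient-plusVec-minus : ∀ e → does (lookup (reorient A plusVec) e ≟ₛ minus) ≡ A e
  reorient-plusVec-minus e with A e | lookup-reorient-plusVec e
  ... | true  | eq = cong (λ a → does (a ≟ₛ minus)) eq
  ... | false | eq = cong (λ a → does (a ≟ₛ minus)) eq

interval1-minus-count : ∀ {m s} → s ≤ m →
  count {m} (λ e → lookup (reorient (interval1 s) plusVec) e ≟ₛ minus) ≡ s
interval1-minus-count {m} {s} s≤m =
  trans (count-cong {m} (λ e → lookup (reorient (interval1 s) plusVec) e ≟ₛ minus) (λ e → suc (toℕ e) ≤? s)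
                    (λ e → trans (reorient-plusVec-minus e) (⌊⌋≡does (suc (toℕ e) ≤? s))))
        (count-below {m} s≤m)
  where open Reorientation (interval1 s)

reorientedCommittee : ∀ {n} (N0 : OM (suc n)) → Simple (OM.Cov N0) → Acyclic (OM.Cov N0) → ∀ {s} → s ≤ suc n →
                      OddBoundedCommittee (reorientCov (interval1 s) (OM.Cov N0)) s
reorientedCommittee N0 (_ , noParallel , noAntiparallel) (plus∈L , _) {s} s≤m =
  subst (OddBoundedCommittee _) (interval1-minus-count s≤m)
    (oddBoundedCommittee (reorient-isOM (OM.isOM N0)) (reorient-noParallelPair noParallel noAntiparallel false)
                         (reorient-noParallelPair noParallel noAntiparallel true) (plusVec , plus∈L , refl)
                         reorient-plusVec-full)
  where open Reorientation (interval1 s)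

simpleCommittee : ∀ {n} (M : OM (suc n)) → Simple (OM.Cov M) → ∃[ s ] OddBoundedCommittee (OM.Cov M) s
simpleCommittee M (loopFree , noParallel , noAntiparallel) =
  let _ , T-tope , _ = loopFree zero in
  _ , oddBoundedCommittee (OM.isOM M) noParallel noAntiparallel (proj₁ T-tope)
                          (tope⇒fullSupport (OM.isOM M) loopFree T-tope)

mainTheorem1 :
    ∀ (m : ℕ) → 1 ≤ m →
      -- (i) and (ii) for the reorientations N^s of a simple acyclic N^0
      (∀ (N0 : OM m) → Simple (OM.Cov N0) → Acyclic (OM.Cov N0) →
        ∀ (s : ℕ) → s ≤ m →
          HasParityBoundedCommittee (reorientCov (interval1 s) (OM.Cov N0))
          × (s ≤ m / 2 →
              ∃[ K ] (IsTopeCommittee (reorientCov (interval1 s) (OM.Cov N0)) K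
                      × length K ≤ 1 + 2 * s)))
      -- consequence of (i): every simple oriented matroid on E_m
      × (∀ (M : OM m) → Simple (OM.Cov M) → HasParityBoundedCommittee (OM.Cov M))
mainTheorem1 (suc n) _ =
  (λ N0 simple acyclic s s≤m →
    let open OddBoundedCommittee (reorientedCommittee N0 simple acyclic s≤m) in
    -- The bound 1 + 2s holds for every s ≤ m.
    parityBounded (reorientedCommittee N0 simple acyclic s≤m) , λ _ → members , isCommittee , ≤1+2s)
  , λ M simple → parityBounded (proj₂ (simpleCommittee M simple))
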